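{- For positive integers $k,q$ with $q>1$, \[ \sum_{n=1}^\infty\frac{P_k(H_n,H_n^{(2)},\dots,H_n^{(k)})}{n(n+1)\cdots (n+q-1)}=\frac{1}{(q-1)!}\left[\zeta(k+1)-\sum_{j=1}^{q-2}\frac{1}{j^{k+1}}\right]. \]
   Context: $H_n^{(r)}=\sum_{i=1}^n i^{ -r}$, $H_n=H_n^{(1)}$. For $k\ge1$, $P_k(y_1,\dots,y_k)=\sum_{m_1+2m_2+\cdots=k}\frac{(-1)^{m_2+m_4+\cdots}}{m_1!m_2!\cdots}\prod_i(y_i/i)^{m_i}$ (sum over tuples of nonnegative integers); equivalently $P_k$ expresses the elementary symmetric function $e_k$ in terms of power sums. $\zeta$ is the Riemann zeta function; an empty sum is $0$. -}

module Defs where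

open import Data.Nat as ℕ using (ℕ; zero; suc; _!)
open import Data.Bool using (Bool; true; false; if_then_else_)
open import Data.Integer using (+_)
open import Data.Rational using (ℚ; 0ℚ; 1ℚ; _+_; _*_; _-_; -_; _/_)
open import Data.List using (List; []; _∷_; [_]; map; concatMap; foldr; upTo; filterᵇ)

-- reciprocal of a natural number as a rational; only ever applied to
-- positive arguments below (the value at 0 is an irrelevant convention)
inv : ℕ → ℚ
inv zero    = 0ℚ
inv (suc n) = + 1 / suc n

infixr 8 _^ℚ_
_^ℚ_ : ℚ → ℕ → ℚ
x ^ℚ zero  = 1ℚ
x ^ℚ suc m = x * (x ^ℚ m)

Σ1 : ℕ → (ℕ → ℚ) → ℚ
Σ1 zero    f = 0ℚ
Σ1 (suc n) f = Σ1 n f + f (suc n)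

H : ℕ → ℕ → ℚ
H r n = Σ1 n (λ i → inv (i ℕ.^ r))

tuples : ℕ → ℕ → List (List ℕ)
tuples zero    b = [ [] ]
tuples (suc l) b = concatMap (λ m → map (m ∷_) (tuples l b)) (upTo (suc b))

weight : ℕ → List ℕ → ℕ
weight i []       = 0
weight i (m ∷ ms) = i ℕ.* m ℕ.+ weight (suc i) ms

isEven : ℕ → Bool
isEven zero          = true
isEven (suc zero)    = false
isEven (suc (suc n)) = isEven n

evenSum : ℕ → List ℕ → ℕ
evenSum i []       = 0
evenSum i (m ∷ ms) = (if isEven i then m else 0) ℕ.+ evenSum (suc i) ms

monomial : (ℕ → ℚ) → ℕ → List ℕ → ℚ
monomial y i []       = 1ℚ
monomial y i (m ∷ ms) = ((y i * inv i) ^ℚ m) * inv (m !) * monomial y (suc i) ms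

sign : ℕ → ℚ
sign n = (- 1ℚ) ^ℚ n

-- P_k(y_1,…,y_k) = Σ_{m_1+2m_2+⋯+k m_k = k} (-1)^{m_2+m_4+⋯} Π_i (y_i/i)^{m_i}/m_i!
-- (tuples (m_1,…,m_k); each m_i ≤ k automatically since Σ i m_i = k;
--  entries m_i with i > k are necessarily 0)
P : ℕ → (ℕ → ℚ) → ℚ
P k y = foldr _+_ 0ℚ
  (map (λ ms → sign (evenSum 1 ms) * monomial y 1 ms)
       (filterᵇ (λ ms → weight 1 ms ℕ.≡ᵇ k) (tuples k k)))

rising : ℕ → ℕ → ℕ
rising n zero    = 1
rising n (suc q) = rising n q ℕ.* (n ℕ.+ q)

lhsPartial : ℕ → ℕ → ℕ → ℚ
lhsPartial k q M = Σ1 M (λ n → P k (λ r → H r n) * inv (rising n q))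

-- partial version of the right-hand side, with ζ(k+1) replaced by its
-- M-th partial sum Σ_{j=1}^{M} j^{-(k+1)} = H_M^{(k+1)}
rhsPartial : ℕ → ℕ → ℕ → ℚ
rhsPartial k q M = inv ((q ℕ.∸ 1) !) * (H (suc k) M - H (suc k) (q ℕ.∸ 2))

module Submission where

-- Write e_k(n) for the k-th elementary symmetric function of 1, 1/2, …, 1/n,
-- ρ(n, p) = 1/(n(n+1)⋯(n+p-1)), and c = q - 1 ≥ 1.  The proof has three parts.
--
-- I.  P_k(H_n, …, H_n^{(k)}) = e_k(n).  The tuple sum defining P_k is rewritten
--     as a recursion over its first exponent; that recursion satisfies Newton's
--     identity w·P_w = Σ_j (-1)^{j-1} y_j P_{w-j} for arbitrary y, e_k(n) satisfies
--     it for the power sums y_r = H_n^{(r)}, and the identity has unique solutions.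
-- II. With S_p = Σ_{n≤M} e_k(n) ρ(n,p) and T_p = Σ_{n≤M} e_k(n) ρ(n+1,p), the
--     partial fractions p·ρ(n,p+1) = ρ(n,p) − ρ(n+1,p) give c!S_{c+1} =
--     (c+1)!S_{c+2} + c!T_{c+1}; iterating from c = q-1 up to M+1 writes the left
--     partial sum as a remainder plus Σ_c c!T_{c+1}, while the right partial sum
--     is (1/(q-1)!)·Σ_c c^{-(k+1)}.  An exact recursion in k shows that c!T_{c+1}
--     differs from c^{-(k+1)} by boundary terms of size c!ρ(M+1,c).
-- III. Estimates: the total error is at most 7(e_0(M) + ⋯ + e_k(M))/(M+1), and
--     e_i(M)² ≤ 9^i (M+1) makes this smaller than any ε > 0 for M large.

open import Defs

module Proof where
  open import Data.Nat as ℕ using (ℕ; zero; suc; _!)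
  import Data.Nat.Properties as ℕP
  import Data.Integer as ℤ
  import Data.Integer.Properties as ℤP
  open import Data.Rational
  open import Data.Rational.Properties
  import Data.Rational.Unnormalised as U
  import Data.Rational.Unnormalised.Properties as UP
  open import Relation.Binary.PropositionalEquality
  open import Relation.Nullary using (¬_; yes; no)
  open import Relation.Nullary.Decidable using (toWitness)
  open import Data.Bool using (Bool; true; false; if_then_else_; _∧_)
  import Data.Bool as Bool
  open import Data.Bool.Properties using (T-≡)
  open import Data.Empty using (⊥-elim)
  open import Data.Sum using (inj₁; inj₂)
  open import Data.Product using (∃; _×_; _,_; proj₁; proj₂)
  open import Data.List using (List; []; _∷_; map; concatMap; foldr; upTo; filterᵇ; _++_; applyUpTo)
  open import Function using (_∘_; id)
  open import Function.Bundles using (Equivalence)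
  open import Data.Rational.Solver
  open +-*-Solver

  -- The embedding ℕ → ℚ, defined by iterated addition of 1 so that its
  -- additive and multiplicative laws follow by induction.
  ι : ℕ → ℚ
  ι zero    = 0ℚ
  ι (suc n) = ι n + 1ℚ

  ι-+ : ∀ a b → ι (a ℕ.+ b) ≡ ι a + ι b
  ι-+ zero    b = sym (+-identityˡ (ι b))
  ι-+ (suc a) b = trans (cong (_+ 1ℚ) (ι-+ a b))
    (solve 3 (λ x y o → (x :+ y) :+ o := (x :+ o) :+ y) refl (ι a) (ι b) 1ℚ)

  ι-* : ∀ a b → ι (a ℕ.* b) ≡ ι a * ι b
  ι-* zero    b = sym (*-zeroˡ (ι b))
  ι-* (suc a) b = trans (ι-+ b (a ℕ.* b)) (trans (cong (ι b +_) (ι-* a b))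
    (solve 2 (λ x y → y :+ x :* y := (x :+ con 1ℚ) :* y) refl (ι a) (ι b)))

  -- `inv (suc n)` really is the inverse of `ι (suc n)`; this is the one place
  -- where the normal form of a rational has to be inspected.
  inv-cancelˡ : ∀ n → inv (suc n) * ι (suc n) ≡ 1ℚ
  inv-cancelˡ n = toℚᵘ-injective (UP.≃-trans (toℚᵘ-homo-* (inv (suc n)) (ι (suc n)))
    (UP.≃-trans (UP.*-cong (toℚᵘ-fromℚᵘ (U.mkℚᵘ (ℤ.+ 1) n)) (ι-unnormalised (suc n)))
    (U.*≡* (trans (ℤP.*-identityʳ _) (trans (ℤP.*-identityˡ _)
      (trans (cong ℤ.+_ (sym (ℕP.*-identityʳ (suc n)))) (sym (ℤP.*-identityˡ _))))))))
    where
    ι-unnormalised : ∀ m → toℚᵘ (ι m) U.≃ U.mkℚᵘ (ℤ.+ m) 0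
    ι-unnormalised zero    = UP.≃-refl
    ι-unnormalised (suc m) = UP.≃-trans (toℚᵘ-homo-+ (ι m) 1ℚ)
      (UP.≃-trans (UP.+-cong (ι-unnormalised m) UP.≃-refl)
      (U.*≡* (cong (ℤ._* ℤ.+ 1) (trans (cong₂ ℤ._+_ (ℤP.*-identityʳ (ℤ.+ m)) refl)
        (cong ℤ.+_ (ℕP.+-comm m 1))))))

  inv-cancelʳ : ∀ n → ι (suc n) * inv (suc n) ≡ 1ℚ
  inv-cancelʳ n = trans (*-comm (ι (suc n)) (inv (suc n))) (inv-cancelˡ n)

  ι-solve : ∀ n {x y} → ι (suc n) * x ≡ y → x ≡ inv (suc n) * y
  ι-solve n {x} {y} h = begin
    x                             ≡⟨ sym (*-identityˡ x) ⟩
    1ℚ * x                        ≡⟨ cong (_* x) (sym (inv-cancelˡ n)) ⟩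
    inv (suc n) * ι (suc n) * x   ≡⟨ *-assoc (inv (suc n)) _ x ⟩
    inv (suc n) * (ι (suc n) * x) ≡⟨ cong (inv (suc n) *_) h ⟩
    inv (suc n) * y               ∎
    where open ≡-Reasoning

  ι-cancel : ∀ n {x y} → ι (suc n) * x ≡ ι (suc n) * y → x ≡ y
  ι-cancel n {x} {y} h = trans (ι-solve n h) (sym (ι-solve n refl))

  inv-* : ∀ a b → inv (a ℕ.* b) ≡ inv a * inv b
  inv-* zero    b       = sym (*-zeroˡ (inv b))
  inv-* (suc a) zero    = trans (cong inv (ℕP.*-zeroʳ a)) (sym (*-zeroʳ (inv (suc a))))
  inv-* (suc a) (suc b) = sym (trans (ι-solve (b ℕ.+ a ℕ.* suc b) (begin
    ι (suc a ℕ.* suc b) * (inv (suc a) * inv (suc b))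
      ≡⟨ cong (_* (inv (suc a) * inv (suc b))) (ι-* (suc a) (suc b)) ⟩
    ι (suc a) * ι (suc b) * (inv (suc a) * inv (suc b))
      ≡⟨ solve 4 (λ x y u v → x :* y :* (u :* v) := (x :* u) :* (y :* v)) refl
           (ι (suc a)) (ι (suc b)) (inv (suc a)) (inv (suc b)) ⟩
    (ι (suc a) * inv (suc a)) * (ι (suc b) * inv (suc b))
      ≡⟨ cong₂ _*_ (inv-cancelʳ a) (inv-cancelʳ b) ⟩
    1ℚ ∎)) (*-identityʳ _))
    where open ≡-Reasoning

  inv-^ : ∀ a r → inv (a ℕ.^ r) ≡ inv a ^ℚ r
  inv-^ a zero    = refl
  inv-^ a (suc r) = trans (inv-* a (a ℕ.^ r)) (cong (inv a *_) (inv-^ a r))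

  Σ< : ℕ → (ℕ → ℚ) → ℚ
  Σ< zero    f = 0ℚ
  Σ< (suc n) f = f 0 + Σ< n (λ t → f (suc t))

  Σ<-cong : ∀ n {f g : ℕ → ℚ} → (∀ t → f t ≡ g t) → Σ< n f ≡ Σ< n g
  Σ<-cong zero    h = refl
  Σ<-cong (suc n) h = cong₂ _+_ (h 0) (Σ<-cong n (λ t → h (suc t)))

  Σ<-cong< : ∀ n {f g : ℕ → ℚ} → (∀ t → t ℕ.< n → f t ≡ g t) → Σ< n f ≡ Σ< n g
  Σ<-cong< zero    h = refl
  Σ<-cong< (suc n) h = cong₂ _+_ (h 0 (ℕ.s≤s ℕ.z≤n)) (Σ<-cong< n (λ t lt → h (suc t) (ℕ.s≤s lt)))

  Σ<-0 : ∀ n → Σ< n (λ _ → 0ℚ) ≡ 0ℚ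
  Σ<-0 zero    = refl
  Σ<-0 (suc n) = trans (+-identityˡ _) (Σ<-0 n)

  Σ<-+ : ∀ n (f g : ℕ → ℚ) → Σ< n (λ t → f t + g t) ≡ Σ< n f + Σ< n g
  Σ<-+ zero    f g = refl
  Σ<-+ (suc n) f g = trans (cong (f 0 + g 0 +_) (Σ<-+ n (λ t → f (suc t)) (λ t → g (suc t))))
    (solve 4 (λ a b c d → (a :+ b) :+ (c :+ d) := (a :+ c) :+ (b :+ d)) refl (f 0) (g 0) _ _)

  Σ<-sub : ∀ n (f g : ℕ → ℚ) → Σ< n (λ t → f t - g t) ≡ Σ< n f - Σ< n g
  Σ<-sub zero    f g = refl
  Σ<-sub (suc n) f g = trans (cong (f 0 - g 0 +_) (Σ<-sub n (λ t → f (suc t)) (λ t → g (suc t))))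
    (solve 4 (λ a b c d → (a :- b) :+ (c :- d) := (a :+ c) :- (b :+ d)) refl (f 0) (g 0) _ _)

  Σ<-*ˡ : ∀ n a (f : ℕ → ℚ) → Σ< n (λ t → a * f t) ≡ a * Σ< n f
  Σ<-*ˡ zero    a f = sym (*-zeroʳ a)
  Σ<-*ˡ (suc n) a f = trans (cong (a * f 0 +_) (Σ<-*ˡ n a (λ t → f (suc t)))) (sym (*-distribˡ-+ a _ _))

  Σ<-last : ∀ n (f : ℕ → ℚ) → Σ< (suc n) f ≡ Σ< n f + f n
  Σ<-last zero    f = trans (+-identityʳ (f 0)) (sym (+-identityˡ (f 0)))
  Σ<-last (suc n) f = trans (cong (f 0 +_) (Σ<-last n (λ t → f (suc t)))) (sym (+-assoc (f 0) _ _))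

  Σ<-swap : ∀ n m (f : ℕ → ℕ → ℚ) →
    Σ< n (λ a → Σ< m (λ b → f a b)) ≡ Σ< m (λ b → Σ< n (λ a → f a b))
  Σ<-swap zero    m f = sym (Σ<-0 m)
  Σ<-swap (suc n) m f = trans (cong (Σ< m (f 0) +_) (Σ<-swap n m (λ a b → f (suc a) b)))
    (sym (Σ<-+ m (f 0) (λ b → Σ< n (λ a → f (suc a) b))))

  Σ1-cong : ∀ M {f g : ℕ → ℚ} → (∀ n → f n ≡ g n) → Σ1 M f ≡ Σ1 M g
  Σ1-cong zero    h = refl
  Σ1-cong (suc M) h = cong₂ _+_ (Σ1-cong M h) (h (suc M))

  H-split : ∀ r a d → H r (a ℕ.+ d) ≡ H r a + Σ< d (λ t → inv (suc a ℕ.+ t) ^ℚ r)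
  H-split r a zero    = trans (cong (H r) (ℕP.+-identityʳ a)) (sym (+-identityʳ (H r a)))
  H-split r a (suc d) = begin
    H r (a ℕ.+ suc d)                          ≡⟨ cong (H r) (ℕP.+-suc a d) ⟩
    H r (a ℕ.+ d) + inv (suc (a ℕ.+ d) ℕ.^ r)  ≡⟨ cong₂ _+_ (H-split r a d) (inv-^ (suc (a ℕ.+ d)) r) ⟩
    (H r a + Σ< d f) + f d                     ≡⟨ +-assoc (H r a) _ _ ⟩
    H r a + (Σ< d f + f d)                     ≡⟨ cong (H r a +_) (sym (Σ<-last d f)) ⟩
    H r a + Σ< (suc d) f                       ∎
    where
    open ≡-Reasoning
    f = λ t → inv (suc a ℕ.+ t) ^ℚ r

  0≤1 : 0ℚ ≤ 1ℚ
  0≤1 = *≤* (ℤ.+≤+ ℕ.z≤n)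

  +-nonNeg : ∀ {a b} → 0ℚ ≤ a → 0ℚ ≤ b → 0ℚ ≤ a + b
  +-nonNeg {a} {b} ha hb = ≤-trans (≤-reflexive (sym (+-identityˡ 0ℚ))) (+-mono-≤ ha hb)

  *-nonNeg : ∀ {a b} → 0ℚ ≤ a → 0ℚ ≤ b → 0ℚ ≤ a * b
  *-nonNeg {a} {b} ha hb = ≤-trans (≤-reflexive (sym (*-zeroˡ b))) (*-monoʳ-≤-nonNeg b {{nonNegative hb}} ha)

  mulˡ-≤ : ∀ {r p q} → 0ℚ ≤ r → p ≤ q → r * p ≤ r * q
  mulˡ-≤ {r} hr = *-monoˡ-≤-nonNeg r {{nonNegative hr}}

  mulʳ-≤ : ∀ {r p q} → 0ℚ ≤ r → p ≤ q → p * r ≤ q * r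
  mulʳ-≤ {r} hr = *-monoʳ-≤-nonNeg r {{nonNegative hr}}

  mul-≤ : ∀ {a b c d} → 0ℚ ≤ b → 0ℚ ≤ c → a ≤ b → c ≤ d → a * c ≤ b * d
  mul-≤ hb hc a≤b c≤d = ≤-trans (mulʳ-≤ hc a≤b) (mulˡ-≤ hb c≤d)

  ≤-of-0≤- : ∀ {a b} → 0ℚ ≤ b - a → a ≤ b
  ≤-of-0≤- {a} {b} h = begin
    a            ≡⟨ sym (+-identityʳ a) ⟩
    a + 0ℚ       ≤⟨ +-monoʳ-≤ a h ⟩
    a + (b - a)  ≡⟨ solve 2 (λ a b → a :+ (b :- a) := b) refl a b ⟩
    b            ∎
    where open ≤-Reasoning

  0≤-of-≤ : ∀ {a b} → a ≤ b → 0ℚ ≤ b - a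
  0≤-of-≤ {a} {b} h = begin
    0ℚ     ≡⟨ sym (+-inverseʳ a) ⟩
    a - a  ≤⟨ +-monoˡ-≤ (- a) h ⟩
    b - a  ∎
    where open ≤-Reasoning

  square-nonNeg : ∀ x → 0ℚ ≤ x * x
  square-nonNeg x with ≤-total 0ℚ x
  ... | inj₁ h = *-nonNeg h h
  ... | inj₂ h = ≤-trans (*-nonNeg (neg-antimono-≤ h) (neg-antimono-≤ h))
    (≤-reflexive (solve 1 (λ x → (:- x) :* (:- x) := x :* x) refl x))

  square-mono⁻¹ : ∀ {x y} → 0ℚ ≤ y → x * x ≤ y * y → x ≤ y
  square-mono⁻¹ {x} {y} 0≤y x²≤y² with x ≤? y
  ... | yes x≤y = x≤y
  ... | no  x≰y = ⊥-elim (<-irrefl refl (≤-<-trans x²≤y² y²<x²))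
    where
    y<x = ≰⇒> x≰y
    y²<x² : y * y < x * x
    y²<x² = ≤-<-trans (mulˡ-≤ 0≤y (<⇒≤ y<x)) (*-monoˡ-<-pos x {{positive (≤-<-trans 0≤y y<x)}} y<x)

  ι-nonNeg : ∀ n → 0ℚ ≤ ι n
  ι-nonNeg zero    = ≤-refl
  ι-nonNeg (suc n) = +-nonNeg (ι-nonNeg n) 0≤1

  ι-mono : ∀ {a b} → a ℕ.≤ b → ι a ≤ ι b
  ι-mono {a} {b} a≤b = begin
    ι a                    ≡⟨ sym (+-identityʳ (ι a)) ⟩
    ι a + 0ℚ               ≤⟨ +-monoʳ-≤ (ι a) (ι-nonNeg (b ℕ.∸ a)) ⟩
    ι a + ι (b ℕ.∸ a)      ≡⟨ sym (ι-+ a (b ℕ.∸ a)) ⟩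
    ι (a ℕ.+ (b ℕ.∸ a))    ≡⟨ cong ι (ℕP.m+[n∸m]≡n a≤b) ⟩
    ι b                    ∎
    where open ≤-Reasoning

  inv-nonNeg : ∀ n → 0ℚ ≤ inv n
  inv-nonNeg zero    = ≤-refl
  inv-nonNeg (suc n) = <⇒≤ (positive⁻¹ (inv (suc n)) {{normalize-pos 1 (suc n)}})

  ι*inv≤1 : ∀ {a b} → a ℕ.≤ b → ι a * inv b ≤ 1ℚ
  ι*inv≤1 {a} {zero}  _   = ≤-trans (≤-reflexive (*-zeroʳ (ι a))) 0≤1
  ι*inv≤1 {a} {suc b} a≤b = ≤-trans (mulʳ-≤ (inv-nonNeg (suc b)) (ι-mono a≤b)) (≤-reflexive (inv-cancelʳ b))

  inv≤1 : ∀ n → inv n ≤ 1ℚ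
  inv≤1 zero    = 0≤1
  inv≤1 (suc n) = ≤-trans (≤-reflexive (sym (*-identityˡ (inv (suc n))))) (ι*inv≤1 {1} {suc n} (ℕ.s≤s ℕ.z≤n))

  inv-anti : ∀ {a b} → 1 ℕ.≤ a → a ℕ.≤ b → inv b ≤ inv a
  inv-anti {suc a} {b} _ a≤b = begin
    inv b                                ≡⟨ sym (*-identityʳ (inv b)) ⟩
    inv b * 1ℚ                           ≡⟨ cong (inv b *_) (sym (inv-cancelʳ a)) ⟩
    inv b * (ι (suc a) * inv (suc a))    ≤⟨ mulˡ-≤ (inv-nonNeg b) (mulʳ-≤ (inv-nonNeg (suc a)) (ι-mono a≤b)) ⟩
    inv b * (ι b * inv (suc a))          ≡⟨ sym (*-assoc (inv b) (ι b) _) ⟩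
    inv b * ι b * inv (suc a)            ≤⟨ mulʳ-≤ (inv-nonNeg (suc a)) (≤-trans (≤-reflexive (*-comm (inv b) (ι b))) (ι*inv≤1 {b} ℕP.≤-refl)) ⟩
    1ℚ * inv (suc a)                     ≡⟨ *-identityˡ _ ⟩
    inv (suc a)                          ∎
    where open ≤-Reasoning

  -- Part I: P_k(H_n, …, H_n^{(k)}) = e_k(n).

  T-ext : ∀ {a b : Bool} → (Bool.T a → Bool.T b) → (Bool.T b → Bool.T a) → a ≡ b
  T-ext {false} {false} _ _ = refl
  T-ext {false} {true}  _ g = ⊥-elim (g _)
  T-ext {true}  {false} f _ = ⊥-elim (f _)
  T-ext {true}  {true}  _ _ = refl

  T-false : ∀ {a : Bool} → ¬ Bool.T a → a ≡ false
  T-false ¬a = T-ext (λ a → ⊥-elim (¬a a)) (λ ())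

  T-true : ∀ {a : Bool} → a ≡ true → Bool.T a
  T-true = Equivalence.from T-≡

  ≡ᵇ-ext : ∀ a b c d → (a ≡ b → c ≡ d) → (c ≡ d → a ≡ b) → (a ℕ.≡ᵇ b) ≡ (c ℕ.≡ᵇ d)
  ≡ᵇ-ext a b c d f g =
    T-ext (ℕP.≡⇒≡ᵇ c d ∘ f ∘ ℕP.≡ᵇ⇒≡ a b) (ℕP.≡⇒≡ᵇ a b ∘ g ∘ ℕP.≡ᵇ⇒≡ c d)

  guard : Bool → ℚ → ℚ
  guard B x = if B then x else 0ℚ

  filteredSum : (List ℕ → ℚ) → (List ℕ → Bool) → List (List ℕ) → ℚ
  filteredSum t p zs = foldr _+_ 0ℚ (map t (filterᵇ p zs))

  filteredSum-++ : ∀ t p xs ys → filteredSum t p (xs ++ ys) ≡ filteredSum t p xs + filteredSum t p ys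
  filteredSum-++ t p []       ys = sym (+-identityˡ _)
  filteredSum-++ t p (x ∷ xs) ys with p x
  ... | true  = trans (cong (t x +_) (filteredSum-++ t p xs ys)) (sym (+-assoc (t x) _ _))
  ... | false = filteredSum-++ t p xs ys

  filteredSum-concatMap : ∀ t p (h : ℕ → List (List ℕ)) xs →
    filteredSum t p (concatMap h xs) ≡ foldr _+_ 0ℚ (map (λ x → filteredSum t p (h x)) xs)
  filteredSum-concatMap t p h []       = refl
  filteredSum-concatMap t p h (x ∷ xs) =
    trans (filteredSum-++ t p (h x) (concatMap h xs)) (cong (filteredSum t p (h x) +_) (filteredSum-concatMap t p h xs))

  filteredSum-map : ∀ t p (g : List ℕ → List ℕ) zs → filteredSum t p (map g zs) ≡ filteredSum (t ∘ g) (p ∘ g) zs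
  filteredSum-map t p g []       = refl
  filteredSum-map t p g (z ∷ zs) with p (g z)
  ... | true  = cong (t (g z) +_) (filteredSum-map t p g zs)
  ... | false = filteredSum-map t p g zs

  filteredSum-cong : ∀ {t t' p p'} zs → (∀ z → t z ≡ t' z) → (∀ z → p z ≡ p' z) →
    filteredSum t p zs ≡ filteredSum t' p' zs
  filteredSum-cong []       ht hp = refl
  filteredSum-cong {t} {t'} {p} {p'} (z ∷ zs) ht hp with p z | p' z | hp z
  ... | true  | .true  | refl = cong₂ _+_ (ht z) (filteredSum-cong zs ht hp)
  ... | false | .false | refl = filteredSum-cong zs ht hp

  filteredSum-none : ∀ t p zs → (∀ z → p z ≡ false) → filteredSum t p zs ≡ 0ℚ
  filteredSum-none t p []       h = refl
  filteredSum-none t p (z ∷ zs) h with p z | h z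
  ... | false | refl = filteredSum-none t p zs h

  filteredSum-*ˡ : ∀ a t p zs → filteredSum (λ z → a * t z) p zs ≡ a * filteredSum t p zs
  filteredSum-*ˡ a t p []       = sym (*-zeroʳ a)
  filteredSum-*ˡ a t p (z ∷ zs) with p z
  ... | true  = trans (cong (a * t z +_) (filteredSum-*ˡ a t p zs)) (sym (*-distribˡ-+ a _ _))
  ... | false = filteredSum-*ˡ a t p zs

  foldr-applyUpTo : ∀ (g : ℕ → ℚ) f n → foldr _+_ 0ℚ (map g (applyUpTo f n)) ≡ Σ< n (g ∘ f)
  foldr-applyUpTo g f zero    = refl
  foldr-applyUpTo g f (suc n) = cong (g (f 0) +_) (foldr-applyUpTo g (f ∘ suc) n)

  sign-+ : ∀ a b → sign (a ℕ.+ b) ≡ sign a * sign b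
  sign-+ zero    b = sym (*-identityˡ (sign b))
  sign-+ (suc a) b = trans (cong ((- 1ℚ) *_) (sign-+ a b)) (sym (*-assoc (- 1ℚ) (sign a) (sign b)))

  coeff : (ℕ → ℚ) → ℕ → ℕ → ℚ
  coeff y i m = sign (if isEven i then m else 0) * ((y i * inv i) ^ℚ m * inv (m !))

  term : (ℕ → ℚ) → ℕ → List ℕ → ℚ
  term y i ms = sign (evenSum i ms) * monomial y i ms

  term-∷ : ∀ y i m ms → term y i (m ∷ ms) ≡ coeff y i m * term y (suc i) ms
  term-∷ y i m ms = trans
    (cong (_* ((y i * inv i) ^ℚ m * inv (m !) * monomial y (suc i) ms)) (sign-+ (if isEven i then m else 0) (evenSum (suc i) ms)))
    (solve 4 (λ A B X D → (A :* B) :* (X :* D) := (A :* X) :* (B :* D)) refl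
      (sign (if isEven i then m else 0)) (sign (evenSum (suc i) ms)) ((y i * inv i) ^ℚ m * inv (m !)) (monomial y (suc i) ms))

  -- Ptail y i l b w: the sum of the terms of P over exponent tuples (m_i, …, m_{i+l-1})
  -- with entries ≤ b and weight Σ j m_j = w, computed by recursion on the first
  -- exponent instead of by enumerating tuples.
  Ptail : (ℕ → ℚ) → ℕ → ℕ → ℕ → ℕ → ℚ
  Ptail y i zero    b w = guard (w ℕ.≡ᵇ 0) 1ℚ
  Ptail y i (suc l) b w =
    Σ< (suc b) (λ m → guard (i ℕ.* m ℕ.≤ᵇ w) (coeff y i m * Ptail y (suc i) l b (w ℕ.∸ i ℕ.* m)))

  tupleSum≡Ptail : ∀ y l i b w →
    filteredSum (term y i) (λ ms → weight i ms ℕ.≡ᵇ w) (tuples l b) ≡ Ptail y i l b w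
  tupleSum≡Ptail y zero    i b zero    = refl
  tupleSum≡Ptail y zero    i b (suc w) = refl
  tupleSum≡Ptail y (suc l) i b w = begin
    filteredSum (term y i) p (concatMap (λ m → map (m ∷_) (tuples l b)) (upTo (suc b)))
      ≡⟨ filteredSum-concatMap (term y i) p (λ m → map (m ∷_) (tuples l b)) (upTo (suc b)) ⟩
    foldr _+_ 0ℚ (map (λ m → filteredSum (term y i) p (map (m ∷_) (tuples l b))) (upTo (suc b)))
      ≡⟨ foldr-applyUpTo (λ m → filteredSum (term y i) p (map (m ∷_) (tuples l b))) id (suc b) ⟩
    Σ< (suc b) (λ m → filteredSum (term y i) p (map (m ∷_) (tuples l b)))
      ≡⟨ Σ<-cong (suc b) first-exponent ⟩
    Ptail y i (suc l) b w ∎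
    where
    open ≡-Reasoning
    p : List ℕ → Bool
    p ms = weight i ms ℕ.≡ᵇ w
    -- tuples starting with m: either i·m ≤ w and the rest has weight w - i·m, or none qualifies
    first-exponent : ∀ m → filteredSum (term y i) p (map (m ∷_) (tuples l b))
      ≡ guard (i ℕ.* m ℕ.≤ᵇ w) (coeff y i m * Ptail y (suc i) l b (w ℕ.∸ i ℕ.* m))
    first-exponent m with i ℕ.* m ℕ.≤ᵇ w in e
    ... | true = begin
        filteredSum (term y i) p (map (m ∷_) (tuples l b))
          ≡⟨ filteredSum-map (term y i) p (m ∷_) (tuples l b) ⟩
        filteredSum (term y i ∘ (m ∷_)) (p ∘ (m ∷_)) (tuples l b)
          ≡⟨ filteredSum-cong (tuples l b) (term-∷ y i m) (λ ms → ≡ᵇ-ext _ _ _ _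
               (λ h → trans (sym (ℕP.m+n∸m≡n (i ℕ.* m) (weight (suc i) ms))) (cong (ℕ._∸ i ℕ.* m) h))
               (λ h → trans (cong (i ℕ.* m ℕ.+_) h) (ℕP.m+[n∸m]≡n (ℕP.≤ᵇ⇒≤ (i ℕ.* m) w (T-true e))))) ⟩
        filteredSum (λ ms → coeff y i m * term y (suc i) ms) (λ ms → weight (suc i) ms ℕ.≡ᵇ (w ℕ.∸ i ℕ.* m)) (tuples l b)
          ≡⟨ filteredSum-*ˡ (coeff y i m) (term y (suc i)) _ (tuples l b) ⟩
        coeff y i m * filteredSum (term y (suc i)) (λ ms → weight (suc i) ms ℕ.≡ᵇ (w ℕ.∸ i ℕ.* m)) (tuples l b)
          ≡⟨ cong (coeff y i m *_) (tupleSum≡Ptail y l (suc i) b (w ℕ.∸ i ℕ.* m)) ⟩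
        coeff y i m * Ptail y (suc i) l b (w ℕ.∸ i ℕ.* m) ∎
    ... | false = trans (filteredSum-map (term y i) p (m ∷_) (tuples l b))
        (filteredSum-none _ _ (tuples l b) (λ ms → T-false (λ h →
           subst Bool.T e (ℕP.≤⇒≤ᵇ (subst (i ℕ.* m ℕ.≤_) (ℕP.≡ᵇ⇒≡ _ w h) (ℕP.m≤m+n (i ℕ.* m) (weight (suc i) ms)))))))

  P≡Ptail : ∀ y k → P k y ≡ Ptail y 1 k k k
  P≡Ptail y k = tupleSum≡Ptail y k 1 k k

  ≤ᵇ-ext : ∀ a b c d → (a ℕ.≤ b → c ℕ.≤ d) → (c ℕ.≤ d → a ℕ.≤ b) → (a ℕ.≤ᵇ b) ≡ (c ℕ.≤ᵇ d)
  ≤ᵇ-ext a b c d f g = T-ext (ℕP.≤⇒≤ᵇ ∘ f ∘ ℕP.≤ᵇ⇒≤ a b) (ℕP.≤⇒≤ᵇ ∘ g ∘ ℕP.≤ᵇ⇒≤ c d)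

  ≤ᵇ-∸ : ∀ a b w → ((a ℕ.≤ᵇ w) ∧ (b ℕ.≤ᵇ w ℕ.∸ a)) ≡ (a ℕ.+ b ℕ.≤ᵇ w)
  ≤ᵇ-∸ a b w with a ℕ.≤ᵇ w in e
  ... | true  = ≤ᵇ-ext _ _ _ _
      (λ h → subst (ℕ._≤ w) (ℕP.+-comm b a) (ℕP.m≤o∸n⇒m+n≤o b a≤w h))
      (λ h → ℕP.m+n≤o⇒m≤o∸n b (subst (ℕ._≤ w) (ℕP.+-comm a b) h))
    where a≤w = ℕP.≤ᵇ⇒≤ a w (T-true e)
  ... | false = sym (T-false (λ h → subst Bool.T e (ℕP.≤⇒≤ᵇ (ℕP.≤-trans (ℕP.m≤m+n a b) (ℕP.≤ᵇ⇒≤ _ w h)))))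

  guard-nest : ∀ A B p X → guard A (p * guard B X) ≡ guard (A ∧ B) (p * X)
  guard-nest true  true  p X = refl
  guard-nest true  false p X = *-zeroʳ p
  guard-nest false B     p X = refl

  guard-swap : ∀ A B C D → (A ∧ B) ≡ (C ∧ D) → ∀ p q r →
    guard A (p * guard B (q * r)) ≡ guard C (q * guard D (p * r))
  guard-swap A B C D e p q r = begin
    guard A (p * guard B (q * r))  ≡⟨ guard-nest A B p (q * r) ⟩
    guard (A ∧ B) (p * (q * r))    ≡⟨ cong₂ guard e (solve 3 (λ p q r → p :* (q :* r) := q :* (p :* r)) refl p q r) ⟩
    guard (C ∧ D) (q * (p * r))    ≡⟨ sym (guard-nest C D q (p * r)) ⟩
    guard C (q * guard D (p * r))  ∎
    where open ≡-Reasoning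

  Σ<-guard : ∀ n B (f : ℕ → ℚ) → Σ< n (λ t → guard B (f t)) ≡ guard B (Σ< n f)
  Σ<-guard n true  f = refl
  Σ<-guard n false f = Σ<-0 n

  altSign : ℕ → ℚ
  altSign j = if isEven j then - 1ℚ else 1ℚ

  newtonTerm : (ℕ → ℚ) → (ℕ → ℚ) → ℕ → ℕ → ℚ
  newtonTerm y F w j = guard (j ℕ.≤ᵇ w) (altSign j * y j * F (w ℕ.∸ j))

  NewtonFrom : (ℕ → ℚ) → (ℕ → ℚ) → ℕ → ℕ → ℕ → Set
  NewtonFrom y F j₀ l b = ∀ w → w ℕ.≤ b → ι w * F w ≡ Σ< l (λ t → newtonTerm y F w (j₀ ℕ.+ t))

  sign-step : ∀ i m → sign (if isEven i then suc m else 0) ≡ altSign i * sign (if isEven i then m else 0)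
  sign-step i m with isEven i
  ... | true  = refl
  ... | false = refl

  coeff-0 : ∀ y i → coeff y i 0 ≡ 1ℚ
  coeff-0 y i with isEven i
  ... | true  = refl
  ... | false = refl

  -- The derivative-like identity behind Newton's identity:
  -- i(m+1) · c_i(m+1) = (-1)^{i-1} y_i · c_i(m).
  coeff-suc : ∀ y i m → ι (suc i ℕ.* suc m) * coeff y (suc i) (suc m) ≡ altSign (suc i) * y (suc i) * coeff y (suc i) m
  coeff-suc y i m = begin
    ι (suc i ℕ.* suc m) * coeff y (suc i) (suc m)
      ≡⟨ cong₂ _*_ (ι-* (suc i) (suc m)) (cong₂ _*_ (sign-step (suc i) m) (cong ((Y ^ℚ suc m) *_) (inv-* (suc m) (m !)))) ⟩
    ι (suc i) * ι (suc m) * (altSign (suc i) * σ * ((Y * Y ^ℚ m) * (inv (suc m) * inv (m !))))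
      ≡⟨ solve 9 (λ a ai b bi si σ yy Ym mi →
           a :* b :* (si :* σ :* ((yy :* ai :* Ym) :* (bi :* mi)))
           := (a :* ai) :* ((b :* bi) :* (si :* yy :* (σ :* (Ym :* mi))))) refl
           (ι (suc i)) (inv (suc i)) (ι (suc m)) (inv (suc m)) (altSign (suc i)) σ (y (suc i)) (Y ^ℚ m) (inv (m !)) ⟩
    (ι (suc i) * inv (suc i)) * ((ι (suc m) * inv (suc m)) * R)
      ≡⟨ cong₂ (λ u v → u * (v * R)) (inv-cancelʳ i) (inv-cancelʳ m) ⟩
    1ℚ * (1ℚ * R) ≡⟨ trans (*-identityˡ _) (*-identityˡ R) ⟩
    R ∎
    where
    open ≡-Reasoning
    Y = y (suc i) * inv (suc i)
    σ = sign (if isEven (suc i) then m else 0)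
    R = altSign (suc i) * y (suc i) * (σ * (Y ^ℚ m * inv (m !)))

  Ptail-0 : ∀ y i l b → Ptail y (suc i) l b 0 ≡ 1ℚ
  Ptail-0 y i zero    b = refl
  Ptail-0 y i (suc l) b = trans (cong₂ _+_ empty-tuple (Σ<-0 b)) (+-identityʳ 1ℚ)
    where
    empty-tuple : guard (suc i ℕ.* 0 ℕ.≤ᵇ 0) (coeff y (suc i) 0 * Ptail y (suc (suc i)) l b (0 ℕ.∸ suc i ℕ.* 0)) ≡ 1ℚ
    empty-tuple rewrite ℕP.*-zeroʳ i = trans (cong₂ _*_ (coeff-0 y (suc i)) (Ptail-0 y (suc i) l b)) (*-identityˡ 1ℚ)

  -- The inductive step of Newton's identity for Ptail: adding the index i₁ in
  -- front of the indices of G gives F, and F satisfies Newton's identity with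
  -- the indices i₁, i₁+1, … as soon as G does with i₁+1, ….
  module NewtonStep (y : ℕ → ℚ) (i l b : ℕ) where
    i₁ : ℕ
    i₁ = suc i
    G F : ℕ → ℚ
    G = Ptail y (suc i₁) l b
    F = Ptail y i₁ (suc l) b

    summand : ℕ → ℕ → ℚ
    summand w m = guard (i₁ ℕ.* m ℕ.≤ᵇ w) (coeff y i₁ m * G (w ℕ.∸ i₁ ℕ.* m))

    -- multiplying the m-th summand of F w by w = i₁m + (w ∸ i₁m) splits it in two
    lowPart highPart : ℕ → ℕ → ℚ
    lowPart  w m = guard (i₁ ℕ.* m ℕ.≤ᵇ w) (ι (i₁ ℕ.* m) * coeff y i₁ m * G (w ℕ.∸ i₁ ℕ.* m))
    highPart w m = guard (i₁ ℕ.* m ℕ.≤ᵇ w) (coeff y i₁ m * (ι (w ℕ.∸ i₁ ℕ.* m) * G (w ℕ.∸ i₁ ℕ.* m)))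

    weight-split : ∀ w m → ι w * summand w m ≡ lowPart w m + highPart w m
    weight-split w m with i₁ ℕ.* m ℕ.≤ᵇ w in e
    ... | true  = trans (cong (λ z → z * (coeff y i₁ m * G (w ℕ.∸ i₁ ℕ.* m)))
                    (trans (cong ι (sym (ℕP.m+[n∸m]≡n (ℕP.≤ᵇ⇒≤ (i₁ ℕ.* m) w (T-true e))))) (ι-+ (i₁ ℕ.* m) (w ℕ.∸ i₁ ℕ.* m))))
           (solve 4 (λ a b c g → (a :+ b) :* (c :* g) := a :* c :* g :+ c :* (b :* g)) refl
             (ι (i₁ ℕ.* m)) (ι (w ℕ.∸ i₁ ℕ.* m)) (coeff y i₁ m) (G (w ℕ.∸ i₁ ℕ.* m)))
    ... | false = trans (*-zeroʳ (ι w)) (sym (+-identityˡ 0ℚ))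

    -- the low parts assemble, via coeff-suc, into the Newton term of index i₁;
    -- the exponent m = b contributes nothing because i₁b > w ∸ i₁ when w ≤ b
    low-parts : ∀ w → w ℕ.≤ b → Σ< (suc b) (lowPart w) ≡ newtonTerm y F w i₁
    low-parts w w≤b = begin
      lowPart w 0 + Σ< b (λ m → lowPart w (suc m))  ≡⟨ cong₂ _+_ low-0 (Σ<-cong b low-suc) ⟩
      0ℚ + Σ< b (λ m → guard (i₁ ℕ.≤ᵇ w) (K * g m))  ≡⟨ +-identityˡ _ ⟩
      Σ< b (λ m → guard (i₁ ℕ.≤ᵇ w) (K * g m))       ≡⟨ Σ<-guard b (i₁ ℕ.≤ᵇ w) (λ m → K * g m) ⟩
      guard (i₁ ℕ.≤ᵇ w) (Σ< b (λ m → K * g m))       ≡⟨ cong (guard (i₁ ℕ.≤ᵇ w)) (Σ<-*ˡ b K g) ⟩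
      guard (i₁ ℕ.≤ᵇ w) (K * Σ< b g)                 ≡⟨ drop-last (i₁ ℕ.≤ᵇ w) refl ⟩
      newtonTerm y F w i₁                            ∎
      where
      open ≡-Reasoning
      K = altSign i₁ * y i₁
      g : ℕ → ℚ
      g m = guard (i₁ ℕ.* m ℕ.≤ᵇ w ℕ.∸ i₁) (coeff y i₁ m * G ((w ℕ.∸ i₁) ℕ.∸ i₁ ℕ.* m))
      low-0 : lowPart w 0 ≡ 0ℚ
      low-0 rewrite ℕP.*-zeroʳ i = trans (cong (_* G w) (*-zeroˡ (coeff y i₁ 0))) (*-zeroˡ (G w))
      low-suc : ∀ m → lowPart w (suc m) ≡ guard (i₁ ℕ.≤ᵇ w) (K * g m)
      low-suc m = begin
        lowPart w (suc m)
          ≡⟨ cong (guard (i₁ ℕ.* suc m ℕ.≤ᵇ w)) (trans (cong (_* G (w ℕ.∸ i₁ ℕ.* suc m)) (coeff-suc y i m)) (*-assoc K _ _)) ⟩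
        guard (i₁ ℕ.* suc m ℕ.≤ᵇ w) (K * (coeff y i₁ m * G (w ℕ.∸ i₁ ℕ.* suc m)))
          ≡⟨ cong₂ (λ u v → guard (u ℕ.≤ᵇ w) (K * (coeff y i₁ m * G (w ℕ.∸ v)))) (ℕP.*-suc i₁ m) (ℕP.*-suc i₁ m) ⟩
        guard (i₁ ℕ.+ i₁ ℕ.* m ℕ.≤ᵇ w) (K * (coeff y i₁ m * G (w ℕ.∸ (i₁ ℕ.+ i₁ ℕ.* m))))
          ≡⟨ cong₂ (λ u v → guard u (K * (coeff y i₁ m * G v))) (sym (≤ᵇ-∸ i₁ (i₁ ℕ.* m) w)) (sym (ℕP.∸-+-assoc w i₁ (i₁ ℕ.* m))) ⟩
        guard ((i₁ ℕ.≤ᵇ w) ∧ (i₁ ℕ.* m ℕ.≤ᵇ w ℕ.∸ i₁)) (K * (coeff y i₁ m * G ((w ℕ.∸ i₁) ℕ.∸ i₁ ℕ.* m)))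
          ≡⟨ sym (guard-nest (i₁ ℕ.≤ᵇ w) _ K _) ⟩
        guard (i₁ ℕ.≤ᵇ w) (K * g m) ∎
      drop-last : ∀ B → B ≡ (i₁ ℕ.≤ᵇ w) → guard B (K * Σ< b g) ≡ guard B (K * F (w ℕ.∸ i₁))
      drop-last false e = refl
      drop-last true  e = cong (K *_) (sym (trans (Σ<-last b g) (trans (cong (Σ< b g +_) g-b) (+-identityʳ _))))
        where
        i₁≤w : i₁ ℕ.≤ w
        i₁≤w = ℕP.≤ᵇ⇒≤ i₁ w (T-true (sym e))
        g-b : g b ≡ 0ℚ
        g-b rewrite T-false {i₁ ℕ.* b ℕ.≤ᵇ w ℕ.∸ i₁} (λ h → ℕP.<-irrefl refl (ℕP.≤-<-trans
            (ℕP.≤-trans (ℕP.m≤n*m b i₁) (ℕP.≤ᵇ⇒≤ _ _ h)) (ℕP.<-≤-trans (ℕP.∸-monoʳ-< {w} {i₁} {0} (ℕ.s≤s ℕ.z≤n) i₁≤w) w≤b))) = refl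

    -- by Newton's identity for G, the high parts give the Newton terms of the
    -- remaining indices i₁+1, …, i₁+l (after exchanging the two sums)
    high-parts : NewtonFrom y G (suc i₁) l b → ∀ w → w ℕ.≤ b →
      Σ< (suc b) (highPart w) ≡ Σ< l (λ t → newtonTerm y F w (suc i₁ ℕ.+ t))
    high-parts newtonG w w≤b = begin
      Σ< (suc b) (highPart w) ≡⟨ Σ<-cong (suc b) expand ⟩
      Σ< (suc b) (λ m → Σ< l (λ t → guard (j t ℕ.≤ᵇ w) (K t * inner t m)))
        ≡⟨ Σ<-swap (suc b) l (λ m t → guard (j t ℕ.≤ᵇ w) (K t * inner t m)) ⟩
      Σ< l (λ t → Σ< (suc b) (λ m → guard (j t ℕ.≤ᵇ w) (K t * inner t m)))
        ≡⟨ Σ<-cong l (λ t → trans (Σ<-guard (suc b) (j t ℕ.≤ᵇ w) (λ m → K t * inner t m))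
             (cong (guard (j t ℕ.≤ᵇ w)) (Σ<-*ˡ (suc b) (K t) (inner t)))) ⟩
      Σ< l (λ t → newtonTerm y F w (j t)) ∎
      where
      open ≡-Reasoning
      j : ℕ → ℕ
      j t = suc i₁ ℕ.+ t
      K : ℕ → ℚ
      K t = altSign (j t) * y (j t)
      inner : ℕ → ℕ → ℚ
      inner t m = guard (i₁ ℕ.* m ℕ.≤ᵇ w ℕ.∸ j t) (coeff y i₁ m * G ((w ℕ.∸ j t) ℕ.∸ i₁ ℕ.* m))
      expand : ∀ m → highPart w m ≡ Σ< l (λ t → guard (j t ℕ.≤ᵇ w) (K t * inner t m))
      expand m = begin
        highPart w m
          ≡⟨ cong (λ z → guard A (coeff y i₁ m * z)) (newtonG wm (ℕP.≤-trans (ℕP.m∸n≤m w (i₁ ℕ.* m)) w≤b)) ⟩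
        guard A (coeff y i₁ m * Σ< l (λ t → guard (j t ℕ.≤ᵇ wm) (K t * G (wm ℕ.∸ j t))))
          ≡⟨ cong (guard A) (sym (Σ<-*ˡ l (coeff y i₁ m) _)) ⟩
        guard A (Σ< l (λ t → coeff y i₁ m * guard (j t ℕ.≤ᵇ wm) (K t * G (wm ℕ.∸ j t))))
          ≡⟨ sym (Σ<-guard l A _) ⟩
        Σ< l (λ t → guard A (coeff y i₁ m * guard (j t ℕ.≤ᵇ wm) (K t * G (wm ℕ.∸ j t))))
          ≡⟨ Σ<-cong l (λ t → trans
               (guard-swap A (j t ℕ.≤ᵇ wm) (j t ℕ.≤ᵇ w) (i₁ ℕ.* m ℕ.≤ᵇ w ℕ.∸ j t) (same-guards t) (coeff y i₁ m) (K t) (G (wm ℕ.∸ j t)))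
               (cong (λ z → guard (j t ℕ.≤ᵇ w) (K t * guard (i₁ ℕ.* m ℕ.≤ᵇ w ℕ.∸ j t) (coeff y i₁ m * G z))) (∸-swap w (i₁ ℕ.* m) (j t)))) ⟩
        Σ< l (λ t → guard (j t ℕ.≤ᵇ w) (K t * inner t m)) ∎
        where
        wm = w ℕ.∸ i₁ ℕ.* m
        A = i₁ ℕ.* m ℕ.≤ᵇ w
        -- both conjunctions say i₁m + j ≤ w
        same-guards : ∀ t → (A ∧ (j t ℕ.≤ᵇ wm)) ≡ ((j t ℕ.≤ᵇ w) ∧ (i₁ ℕ.* m ℕ.≤ᵇ w ℕ.∸ j t))
        same-guards t = trans (≤ᵇ-∸ (i₁ ℕ.* m) (j t) w)
          (trans (cong (ℕ._≤ᵇ w) (ℕP.+-comm (i₁ ℕ.* m) (j t))) (sym (≤ᵇ-∸ (j t) (i₁ ℕ.* m) w)))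
        ∸-swap : ∀ u a c → (u ℕ.∸ a) ℕ.∸ c ≡ (u ℕ.∸ c) ℕ.∸ a
        ∸-swap u a c = trans (ℕP.∸-+-assoc u a c) (trans (cong (u ℕ.∸_) (ℕP.+-comm a c)) (sym (ℕP.∸-+-assoc u c a)))

    newton-step : NewtonFrom y G (suc i₁) l b → NewtonFrom y F i₁ (suc l) b
    newton-step newtonG w w≤b = begin
      ι w * F w                                  ≡⟨ sym (Σ<-*ˡ (suc b) (ι w) (summand w)) ⟩
      Σ< (suc b) (λ m → ι w * summand w m)       ≡⟨ Σ<-cong (suc b) (weight-split w) ⟩
      Σ< (suc b) (λ m → lowPart w m + highPart w m)
        ≡⟨ Σ<-+ (suc b) (lowPart w) (highPart w) ⟩
      Σ< (suc b) (lowPart w) + Σ< (suc b) (highPart w)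
        ≡⟨ cong₂ _+_ (low-parts w w≤b) (high-parts newtonG w w≤b) ⟩
      newtonTerm y F w i₁ + Σ< l (λ t → newtonTerm y F w (suc i₁ ℕ.+ t))
        ≡⟨ sym (cong₂ _+_ (cong (newtonTerm y F w) (ℕP.+-identityʳ i₁))
             (Σ<-cong l (λ t → cong (newtonTerm y F w) (ℕP.+-suc i₁ t)))) ⟩
      Σ< (suc l) (λ t → newtonTerm y F w (i₁ ℕ.+ t)) ∎
      where open ≡-Reasoning

  Ptail-newton : ∀ y i l b → NewtonFrom y (Ptail y (suc i) l b) (suc i) l b
  Ptail-newton y i zero    b zero    _ = refl
  Ptail-newton y i zero    b (suc w) _ = *-zeroʳ (ι (suc w))
  Ptail-newton y i (suc l) b = NewtonStep.newton-step y i l b (Ptail-newton y (suc i) l b)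

  -- elem k n = e_k(1, 1/2, …, 1/n), the k-th elementary symmetric function of
  -- the reciprocals 1/i, i ≤ n, computed from e_k(x₁…x_{n+1}) = e_k(x₁…x_n) + e_{k-1}(x₁…x_n)·x_{n+1}.
  elem : ℕ → ℕ → ℚ
  elem zero    n       = 1ℚ
  elem (suc k) zero    = 0ℚ
  elem (suc k) (suc n) = elem (suc k) n + elem k n * inv (suc n)

  elemBelow : ℕ → ℕ → ℚ
  elemBelow n zero    = 0ℚ
  elemBelow n (suc v) = elem v n

  elem-suc : ∀ n v → elem v (suc n) ≡ elem v n + inv (suc n) * elemBelow n v
  elem-suc n zero    = sym (trans (cong (1ℚ +_) (*-zeroʳ (inv (suc n)))) (+-identityʳ 1ℚ))
  elem-suc n (suc v) = cong (elem (suc v) n +_) (*-comm (elem v n) (inv (suc n)))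

  H-suc : ∀ r n → H r (suc n) ≡ H r n + inv (suc n) ^ℚ r
  H-suc r n = cong (H r n +_) (inv-^ (suc n) r)

  altSign-suc : ∀ t → altSign (suc (suc t)) ≡ - altSign (suc t)
  altSign-suc zero          = refl
  altSign-suc (suc zero)    = refl
  altSign-suc (suc (suc t)) = altSign-suc t

  newtonSum : (ℕ → ℚ) → (ℕ → ℚ) → ℕ → ℚ
  newtonSum p F w = Σ< w (λ t → altSign (suc t) * p (suc t) * F (w ℕ.∸ suc t))

  newtonTerms≡newtonSum : ∀ y F k w → w ℕ.≤ k → Σ< k (λ t → newtonTerm y F w (1 ℕ.+ t)) ≡ newtonSum y F w
  newtonTerms≡newtonSum y F k w = drop-vanishing w k (λ t → altSign (suc t) * y (suc t) * F (w ℕ.∸ suc t))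
    where
    drop-vanishing : ∀ w k (f : ℕ → ℚ) → w ℕ.≤ k → Σ< k (λ t → guard (suc t ℕ.≤ᵇ w) (f t)) ≡ Σ< w f
    drop-vanishing zero    k       f _         = Σ<-0 k
    drop-vanishing (suc w) (suc k) f (ℕ.s≤s h) = cong (f 0 +_) (drop-vanishing w k (λ t → f (suc t)) h)

  alternating-powers : ∀ n w →
    Σ< w (λ t → altSign (suc t) * inv (suc n) ^ℚ (suc t) * elem (w ℕ.∸ suc t) (suc n)) ≡ inv (suc n) * elemBelow n w
  alternating-powers n zero    = sym (*-zeroʳ (inv (suc n)))
  alternating-powers n (suc v) = begin
    f₀ + Σ< v (λ t → altSign (suc (suc t)) * a ^ℚ (suc (suc t)) * elem (v ℕ.∸ suc t) (suc n))
      ≡⟨ cong (f₀ +_) (Σ<-cong v (λ t → trans (cong (λ z → z * a ^ℚ (suc (suc t)) * elem (v ℕ.∸ suc t) (suc n)) (altSign-suc t))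
           (solve 4 (λ σ x A e → (:- σ) :* (x :* A) :* e := (:- x) :* (σ :* A :* e)) refl
             (altSign (suc t)) a (a ^ℚ suc t) (elem (v ℕ.∸ suc t) (suc n))))) ⟩
    f₀ + Σ< v (λ t → (- a) * f t)
      ≡⟨ cong (f₀ +_) (trans (Σ<-*ˡ v (- a) f) (cong ((- a) *_) (alternating-powers n v))) ⟩
    1ℚ * (a * 1ℚ) * elem v (suc n) + (- a) * (a * elemBelow n v)
      ≡⟨ cong (λ z → 1ℚ * (a * 1ℚ) * z + (- a) * (a * elemBelow n v)) (elem-suc n v) ⟩
    1ℚ * (a * 1ℚ) * (elem v n + a * elemBelow n v) + (- a) * (a * elemBelow n v)
      ≡⟨ solve 3 (λ a e f → con 1ℚ :* (a :* con 1ℚ) :* (e :+ a :* f) :+ (:- a) :* (a :* f) := a :* e) refl a (elem v n) (elemBelow n v) ⟩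
    a * elem v n ∎
    where
    open ≡-Reasoning
    a = inv (suc n)
    f₀ = altSign 1 * a ^ℚ 1 * elem v (suc n)
    f : ℕ → ℚ
    f t = altSign (suc t) * a ^ℚ (suc t) * elem (v ℕ.∸ suc t) (suc n)

  elem-newton : ∀ n w → ι w * elem w n ≡ newtonSum (λ r → H r n) (λ v → elem v n) w
  elem-newton zero    zero    = refl
  elem-newton zero    (suc w) = trans (*-zeroʳ (ι (suc w))) (sym (trans (Σ<-cong (suc w) (λ t →
    trans (cong (λ z → z * elem (w ℕ.∸ t) 0) (*-zeroʳ (altSign (suc t)))) (*-zeroˡ (elem (w ℕ.∸ t) 0)))) (Σ<-0 (suc w))))
  elem-newton (suc n) zero    = refl
  elem-newton (suc n) (suc v) = sym (begin
    Σ< (suc v) (λ t → altSign (suc t) * H (suc t) (suc n) * elem (v ℕ.∸ t) (suc n))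
      ≡⟨ Σ<-cong (suc v) (λ t → trans (cong (λ z → altSign (suc t) * z * elem (v ℕ.∸ t) (suc n)) (H-suc (suc t) n))
            (trans (cong (λ z → altSign (suc t) * (H (suc t) n + a ^ℚ suc t) * z) (elem-suc n (v ℕ.∸ t)))
            (solve 6 (λ σ h A e a f → σ :* (h :+ A) :* (e :+ a :* f) := (σ :* h :* e :+ a :* (σ :* h :* f)) :+ σ :* A :* (e :+ a :* f)) refl
              (altSign (suc t)) (H (suc t) n) (a ^ℚ suc t) (elem (v ℕ.∸ t) n) a (elemBelow n (v ℕ.∸ t))))) ⟩
    Σ< (suc v) (λ t → (f₁ t + a * f₂ t) + f₃ t)
      ≡⟨ Σ<-+ (suc v) (λ t → f₁ t + a * f₂ t) f₃ ⟩
    Σ< (suc v) (λ t → f₁ t + a * f₂ t) + Σ< (suc v) f₃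
      ≡⟨ cong₂ _+_ (Σ<-+ (suc v) f₁ (λ t → a * f₂ t))
           (trans (Σ<-cong (suc v) (λ t → cong (altSign (suc t) * a ^ℚ suc t *_) (sym (elem-suc n (v ℕ.∸ t)))))
             (alternating-powers n (suc v))) ⟩
    (Σ< (suc v) f₁ + Σ< (suc v) (λ t → a * f₂ t)) + a * elem v n
      ≡⟨ cong (λ z → z + a * elem v n) (cong₂ _+_ (sym (elem-newton n (suc v))) (trans (Σ<-*ˡ (suc v) a f₂) (cong (a *_) shifted))) ⟩
    (ι (suc v) * elem (suc v) n + a * (ι v * elem v n)) + a * elem v n
      ≡⟨ solve 4 (λ i es ev a → ((i :+ con 1ℚ) :* es :+ a :* (i :* ev)) :+ a :* ev := (i :+ con 1ℚ) :* (es :+ ev :* a)) refl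
           (ι v) (elem (suc v) n) (elem v n) a ⟩
    ι (suc v) * elem (suc v) (suc n) ∎)
    where
    open ≡-Reasoning
    a = inv (suc n)
    f₁ f₂ f₃ : ℕ → ℚ
    f₁ t = altSign (suc t) * H (suc t) n * elem (v ℕ.∸ t) n
    f₂ t = altSign (suc t) * H (suc t) n * elemBelow n (v ℕ.∸ t)
    f₃ t = altSign (suc t) * a ^ℚ suc t * (elem (v ℕ.∸ t) n + a * elemBelow n (v ℕ.∸ t))
    -- the sum with e_{·-1} is Newton's sum at weight v, its last term being 0
    shifted : Σ< (suc v) f₂ ≡ ι v * elem v n
    shifted = begin
      Σ< (suc v) f₂     ≡⟨ Σ<-last v f₂ ⟩
      Σ< v f₂ + f₂ v
        ≡⟨ cong₂ _+_ (Σ<-cong< v (λ t t<v → cong (λ z → altSign (suc t) * H (suc t) n * elemBelow n z) (ℕP.+-∸-assoc 1 t<v)))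
                     (trans (cong (λ z → altSign (suc v) * H (suc v) n * elemBelow n z) (ℕP.n∸n≡0 v)) (*-zeroʳ (altSign (suc v) * H (suc v) n))) ⟩
      newtonSum (λ r → H r n) (λ u → elem u n) v + 0ℚ
        ≡⟨ trans (+-identityʳ _) (sym (elem-newton n v)) ⟩
      ι v * elem v n ∎

  newton-unique : ∀ (p X Y : ℕ → ℚ) k → X 0 ≡ Y 0 →
    (∀ w → w ℕ.≤ k → ι w * X w ≡ newtonSum p X w) →
    (∀ w → w ℕ.≤ k → ι w * Y w ≡ newtonSum p Y w) →
    ∀ w → w ℕ.≤ k → X w ≡ Y w
  newton-unique p X Y k X0≡Y0 newtonX newtonY w w≤k = agree (suc w) w ℕP.≤-refl w≤k
    where
    agree : ∀ N w → w ℕ.< N → w ℕ.≤ k → X w ≡ Y w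
    agree (suc N) zero    _          _   = X0≡Y0
    agree (suc N) (suc v) (ℕ.s≤s v<N) v<k = ι-cancel v
      (trans (newtonX (suc v) v<k) (trans (Σ<-cong< (suc v) (λ t t<v →
        cong (altSign (suc t) * p (suc t) *_)
          (agree N (v ℕ.∸ t) (ℕP.≤-trans (ℕ.s≤s (ℕP.m∸n≤m v t)) v<N) (ℕP.≤-trans (ℕP.m∸n≤m (suc v) (suc t)) v<k))))
       (sym (newtonY (suc v) v<k))))

  P-harmonic : ∀ k n → P k (λ r → H r n) ≡ elem k n
  P-harmonic k n = trans (P≡Ptail y k) (newton-unique y (Ptail y 1 k k) (λ w → elem w n) k (Ptail-0 y 0 k k)
    (λ w w≤k → trans (Ptail-newton y 0 k k w w≤k) (newtonTerms≡newtonSum y (Ptail y 1 k k) k w w≤k))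
    (λ w _ → elem-newton n w) k ℕP.≤-refl)
    where y = λ r → H r n

  -- Part II: exact identities for the partial sums.

  ρ : ℕ → ℕ → ℚ
  ρ n p = inv (rising n p)

  inv-! : ∀ c → ι (c !) * inv (c !) ≡ 1ℚ
  inv-! c with c ! | ℕP.1≤n! c
  ... | suc f | _ = inv-cancelʳ f

  rising-1 : ∀ c → rising 1 c ≡ c !
  rising-1 zero    = refl
  rising-1 (suc c) = trans (cong (ℕ._* suc c) (rising-1 c)) (ℕP.*-comm (c !) (suc c))

  ρ-1 : ∀ c → ι (c !) * ρ 1 c ≡ 1ℚ
  ρ-1 c = trans (cong (λ z → ι (c !) * inv z) (rising-1 c)) (inv-! c)

  ρ-suc-last : ∀ n p → ρ n (suc p) ≡ ρ n p * inv (n ℕ.+ p)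
  ρ-suc-last n p = inv-* (rising n p) (n ℕ.+ p)

  ρ-suc-first : ∀ n p → ρ n (suc p) ≡ inv n * ρ (suc n) p
  ρ-suc-first n p = trans (cong inv (rising-first n p)) (inv-* n (rising (suc n) p))
    where
    rising-first : ∀ n p → rising n (suc p) ≡ n ℕ.* rising (suc n) p
    rising-first n zero    = trans (ℕP.*-identityˡ (n ℕ.+ 0)) (trans (ℕP.+-identityʳ n) (sym (ℕP.*-identityʳ n)))
    rising-first n (suc p) = begin
      rising n (suc p) ℕ.* (n ℕ.+ suc p)      ≡⟨ cong₂ ℕ._*_ (rising-first n p) (ℕP.+-suc n p) ⟩
      n ℕ.* rising (suc n) p ℕ.* (suc n ℕ.+ p) ≡⟨ ℕP.*-assoc n _ _ ⟩
      n ℕ.* rising (suc n) (suc p)            ∎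
      where open ≡-Reasoning

  ρ-cancel-last : ∀ n p → ι (suc n ℕ.+ p) * ρ (suc n) (suc p) ≡ ρ (suc n) p
  ρ-cancel-last n p = begin
    ι (suc n ℕ.+ p) * ρ (suc n) (suc p)                  ≡⟨ cong (ι (suc n ℕ.+ p) *_) (ρ-suc-last (suc n) p) ⟩
    ι (suc n ℕ.+ p) * (ρ (suc n) p * inv (suc n ℕ.+ p))  ≡⟨ solve 3 (λ a b c → a :* (b :* c) := b :* (a :* c)) refl (ι (suc n ℕ.+ p)) (ρ (suc n) p) (inv (suc n ℕ.+ p)) ⟩
    ρ (suc n) p * (ι (suc n ℕ.+ p) * inv (suc n ℕ.+ p))  ≡⟨ cong (ρ (suc n) p *_) (inv-cancelʳ (n ℕ.+ p)) ⟩
    ρ (suc n) p * 1ℚ                                     ≡⟨ *-identityʳ _ ⟩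
    ρ (suc n) p                                          ∎
    where open ≡-Reasoning

  ρ-cancel-first : ∀ n p → ι (suc n) * ρ (suc n) (suc p) ≡ ρ (suc (suc n)) p
  ρ-cancel-first n p = begin
    ι (suc n) * ρ (suc n) (suc p)                   ≡⟨ cong (ι (suc n) *_) (ρ-suc-first (suc n) p) ⟩
    ι (suc n) * (inv (suc n) * ρ (suc (suc n)) p)   ≡⟨ sym (*-assoc (ι (suc n)) _ _) ⟩
    ι (suc n) * inv (suc n) * ρ (suc (suc n)) p     ≡⟨ cong (_* ρ (suc (suc n)) p) (inv-cancelʳ n) ⟩
    1ℚ * ρ (suc (suc n)) p                          ≡⟨ *-identityˡ _ ⟩
    ρ (suc (suc n)) p                               ∎
    where open ≡-Reasoning

  -- The partial fraction identity p / (n⋯(n+p)) = 1/(n⋯(n+p-1)) − 1/((n+1)⋯(n+p)),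
  -- which makes every sum below telescope.
  ρ-telescope : ∀ n p → ι p * ρ (suc n) (suc p) ≡ ρ (suc n) p - ρ (suc (suc n)) p
  ρ-telescope n p = begin
    ι p * X                                  ≡⟨ solve 3 (λ a b x → b :* x := (a :+ b) :* x :- a :* x) refl (ι (suc n)) (ι p) X ⟩
    (ι (suc n) + ι p) * X - ι (suc n) * X    ≡⟨ cong₂ (λ u v → u * X - v) (sym (ι-+ (suc n) p)) (ρ-cancel-first n p) ⟩
    ι (suc n ℕ.+ p) * X - ρ (suc (suc n)) p  ≡⟨ cong (_- ρ (suc (suc n)) p) (ρ-cancel-last n p) ⟩
    ρ (suc n) p - ρ (suc (suc n)) p          ∎
    where
    open ≡-Reasoning
    X = ρ (suc n) (suc p)

  -- S k M p = Σ_{n=1}^{M} e_k(n)/(n⋯(n+p-1)) and its shifted version T.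
  -- The left-hand side of the corollary is S k q M.
  S T : ℕ → ℕ → ℕ → ℚ
  S k M p = Σ1 M (λ n → elem k n * ρ n p)
  T k M p = Σ1 M (λ n → elem k n * ρ (suc n) p)

  S-telescope : ∀ k M p → ι p * S k M (suc p) ≡ S k M p - T k M p
  S-telescope k zero    p = *-zeroʳ (ι p)
  S-telescope k (suc M) p = begin
    ι p * (S k M (suc p) + e * ρ (suc M) (suc p))                ≡⟨ *-distribˡ-+ (ι p) _ _ ⟩
    ι p * S k M (suc p) + ι p * (e * ρ (suc M) (suc p))
      ≡⟨ cong₂ _+_ (S-telescope k M p)
           (trans (solve 3 (λ a b c → a :* (b :* c) := b :* (a :* c)) refl (ι p) e (ρ (suc M) (suc p))) (cong (e *_) (ρ-telescope M p))) ⟩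
    (S k M p - T k M p) + e * (ρ (suc M) p - ρ (suc (suc M)) p)
      ≡⟨ solve 5 (λ s t e a b → (s :- t) :+ e :* (a :- b) := (s :+ e :* a) :- (t :+ e :* b)) refl
           (S k M p) (T k M p) e (ρ (suc M) p) (ρ (suc (suc M)) p) ⟩
    S k (suc M) p - T k (suc M) p                                ∎
    where
    open ≡-Reasoning
    e = elem k (suc M)

  -- The normalised sums Sₙ k M c = c!·S k M (c+1) and Tₙ k M c = c!·T k M (c+1);
  -- the corollary is about Sₙ k M (q-1), and Tₙ k M c tends to c^{-(k+1)}.
  Sₙ Tₙ : ℕ → ℕ → ℕ → ℚ
  Sₙ k M c = ι (c !) * S k M (suc c)
  Tₙ k M c = ι (c !) * T k M (suc c)

  Sₙ-step : ∀ k M c → Sₙ k M c ≡ Sₙ k M (suc c) + Tₙ k M c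
  Sₙ-step k M c = begin
    ι (c !) * S₁                           ≡⟨ cong (ι (c !) *_) (solve 2 (λ a b → a := (a :- b) :+ b) refl S₁ T₁) ⟩
    ι (c !) * ((S₁ - T₁) + T₁)             ≡⟨ cong (λ z → ι (c !) * (z + T₁)) (sym (S-telescope k M (suc c))) ⟩
    ι (c !) * (ι (suc c) * S₂ + T₁)        ≡⟨ solve 4 (λ f i s t → f :* (i :* s :+ t) := (i :* f) :* s :+ f :* t) refl (ι (c !)) (ι (suc c)) S₂ T₁ ⟩
    ι (suc c) * ι (c !) * S₂ + ι (c !) * T₁ ≡⟨ cong (λ z → z * S₂ + ι (c !) * T₁) (sym (ι-* (suc c) (c !))) ⟩
    Sₙ k M (suc c) + Tₙ k M c              ∎
    where
    open ≡-Reasoning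
    S₁ = S k M (suc c)
    S₂ = S k M (suc (suc c))
    T₁ = T k M (suc c)

  Sₙ-telescope : ∀ k M d c → Sₙ k M c ≡ Sₙ k M (c ℕ.+ d) + Σ< d (λ t → Tₙ k M (c ℕ.+ t))
  Sₙ-telescope k M zero    c = trans (cong (Sₙ k M) (sym (ℕP.+-identityʳ c))) (sym (+-identityʳ _))
  Sₙ-telescope k M (suc d) c = begin
    Sₙ k M c                                              ≡⟨ Sₙ-telescope k M d c ⟩
    Sₙ k M (c ℕ.+ d) + Σ< d f                             ≡⟨ cong (_+ Σ< d f) (Sₙ-step k M (c ℕ.+ d)) ⟩
    (Sₙ k M (suc (c ℕ.+ d)) + f d) + Σ< d f
      ≡⟨ solve 3 (λ a b c → (a :+ b) :+ c := a :+ (c :+ b)) refl (Sₙ k M (suc (c ℕ.+ d))) (f d) (Σ< d f) ⟩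
    Sₙ k M (suc (c ℕ.+ d)) + (Σ< d f + f d)               ≡⟨ cong₂ _+_ (cong (Sₙ k M) (sym (ℕP.+-suc c d))) (sym (Σ<-last d f)) ⟩
    Sₙ k M (c ℕ.+ suc d) + Σ< (suc d) f                   ∎
    where
    open ≡-Reasoning
    f = λ t → Tₙ k M (c ℕ.+ t)

  -- V j p M = Σ_{n=0}^{M-1} e_j(n)/((n+1)⋯(n+p)).  Unlike T it starts at n = 0,
  -- which makes the recursion in j below exact.
  V : ℕ → ℕ → ℕ → ℚ
  V j p zero    = 0ℚ
  V j p (suc M) = V j p M + elem j M * ρ (suc M) p

  V-0 : ∀ c M → ι c * V 0 (suc c) M ≡ ρ 1 c - ρ (suc M) c
  V-0 c zero    = trans (*-zeroʳ (ι c)) (sym (+-inverseʳ (ρ 1 c)))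
  V-0 c (suc M) = begin
    ι c * (V 0 (suc c) M + 1ℚ * ρ (suc M) (suc c))
      ≡⟨ solve 3 (λ i v x → i :* (v :+ con 1ℚ :* x) := i :* v :+ i :* x) refl (ι c) (V 0 (suc c) M) (ρ (suc M) (suc c)) ⟩
    ι c * V 0 (suc c) M + ι c * ρ (suc M) (suc c)          ≡⟨ cong₂ _+_ (V-0 c M) (ρ-telescope M c) ⟩
    (ρ 1 c - ρ (suc M) c) + (ρ (suc M) c - ρ (suc (suc M)) c)
      ≡⟨ solve 3 (λ a b d → (a :- b) :+ (b :- d) := a :- d) refl (ρ 1 c) (ρ (suc M) c) (ρ (suc (suc M)) c) ⟩
    ρ 1 c - ρ (suc (suc M)) c                              ∎
    where open ≡-Reasoning

  -- The recursion c·V_{j+1} = V_j − (boundary term); in the limit M → ∞ it gives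
  -- V_j(c+1) = 1/(c^{j+1} c!).
  V-step : ∀ j c M → ι c * V (suc j) (suc c) M ≡ V j (suc c) M - elem (suc j) M * ρ (suc M) c
  V-step j c zero    = trans (*-zeroʳ (ι c)) (sym (trans (cong (λ z → 0ℚ - z) (*-zeroˡ (ρ 1 c))) (+-identityʳ 0ℚ)))
  V-step j c (suc M) = begin
    ι c * (V₁ + e₁ * X)                                    ≡⟨ solve 4 (λ i v e x → i :* (v :+ e :* x) := i :* v :+ e :* (i :* x)) refl (ι c) V₁ e₁ X ⟩
    ι c * V₁ + e₁ * (ι c * X)                              ≡⟨ cong₂ (λ u v → u + e₁ * v) (V-step j c M) (ρ-telescope M c) ⟩
    (V₀ - e₁ * ρ (suc M) c) + e₁ * (ρ (suc M) c - ρ₂)      ≡⟨ solve 4 (λ v e r s → (v :- e :* r) :+ e :* (r :- s) := v :- e :* s) refl V₀ e₁ (ρ (suc M) c) ρ₂ ⟩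
    V₀ - e₁ * ρ₂                                           ≡⟨ solve 5 (λ v e₀ e₁ a s → v :- e₁ :* s := (v :+ e₀ :* (a :* s)) :- (e₁ :+ e₀ :* a) :* s) refl V₀ e₀ e₁ a ρ₂ ⟩
    (V₀ + e₀ * (a * ρ₂)) - (e₁ + e₀ * a) * ρ₂              ≡⟨ cong (λ z → (V₀ + e₀ * z) - (e₁ + e₀ * a) * ρ₂) (sym (ρ-suc-first (suc M) c)) ⟩
    (V₀ + e₀ * X) - (e₁ + e₀ * a) * ρ₂                     ∎
    where
    open ≡-Reasoning
    V₀ = V j (suc c) M
    V₁ = V (suc j) (suc c) M
    e₀ = elem j M
    e₁ = elem (suc j) M
    a  = inv (suc M)
    X  = ρ (suc M) (suc c)
    ρ₂ = ρ (suc (suc M)) c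

  -- For k ≥ 1, T and V only differ in where the range of summation starts and ends.
  T-V : ∀ j c M → T (suc j) M (suc c) ≡ V (suc j) (suc c) M + elem (suc j) M * ρ (suc M) (suc c)
  T-V j c zero    = sym (trans (+-identityˡ (0ℚ * ρ 1 (suc c))) (*-zeroˡ (ρ 1 (suc c))))
  T-V j c (suc M) = cong (_+ elem (suc j) (suc M) * ρ (suc (suc M)) (suc c)) (T-V j c M)

  -- R c M = c!/((M+1)⋯(M+c)), the size of the boundary terms.
  R : ℕ → ℕ → ℚ
  R c M = ι (c !) * ρ (suc M) c

  -- How far c!·V_j(c+1) is from its limit c^{-(j+1)}.
  defect : ℕ → ℕ → ℕ → ℚ
  defect j c M = inv c ^ℚ (suc j) - ι (c !) * V j (suc c) M

  defect-0 : ∀ c' M → defect 0 (suc c') M ≡ inv (suc c') * R (suc c') M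
  defect-0 c' M = begin
    inv c * 1ℚ - ι (c !) * V 0 (suc c) M               ≡⟨ cong (λ z → inv c * 1ℚ - ι (c !) * z) (ι-solve c' (V-0 c M)) ⟩
    inv c * 1ℚ - ι (c !) * (inv c * (ρ 1 c - ρ (suc M) c))
      ≡⟨ solve 4 (λ a f x y → a :* con 1ℚ :- f :* (a :* (x :- y)) := a :* (con 1ℚ :- f :* x) :+ a :* (f :* y)) refl
           (inv c) (ι (c !)) (ρ 1 c) (ρ (suc M) c) ⟩
    inv c * (1ℚ - ι (c !) * ρ 1 c) + inv c * R c M      ≡⟨ cong (λ z → inv c * (1ℚ - z) + inv c * R c M) (ρ-1 c) ⟩
    inv c * (1ℚ - 1ℚ) + inv c * R c M                   ≡⟨ trans (cong (_+ inv c * R c M) (*-zeroʳ (inv c))) (+-identityˡ _) ⟩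
    inv c * R c M                                       ∎
    where
    open ≡-Reasoning
    c = suc c'

  defect-suc : ∀ j c' M → defect (suc j) (suc c') M ≡ inv (suc c') * (defect j (suc c') M + elem (suc j) M * R (suc c') M)
  defect-suc j c' M = begin
    inv c * inv c ^ℚ (suc j) - ι (c !) * V (suc j) (suc c) M
      ≡⟨ cong (λ z → inv c * inv c ^ℚ (suc j) - ι (c !) * z) (ι-solve c' (V-step j c M)) ⟩
    inv c * inv c ^ℚ (suc j) - ι (c !) * (inv c * (V j (suc c) M - elem (suc j) M * ρ (suc M) c))
      ≡⟨ solve 6 (λ a p f v e r → a :* p :- f :* (a :* (v :- e :* r)) := a :* ((p :- f :* v) :+ e :* (f :* r))) refl
          (inv c) (inv c ^ℚ (suc j)) (ι (c !)) (V j (suc c) M) (elem (suc j) M) (ρ (suc M) c) ⟩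
    inv c * (defect j c M + elem (suc j) M * R c M) ∎
    where
    open ≡-Reasoning
    c = suc c'

  Tₙ-error : ∀ j c M → Tₙ (suc j) M c - inv c ^ℚ (suc (suc j)) ≡ elem (suc j) M * (ι (c !) * ρ (suc M) (suc c)) - defect (suc j) c M
  Tₙ-error j c M = begin
    ι (c !) * T (suc j) M (suc c) - p                                   ≡⟨ cong (λ z → ι (c !) * z - p) (T-V j c M) ⟩
    ι (c !) * (V (suc j) (suc c) M + elem (suc j) M * ρ (suc M) (suc c)) - p
      ≡⟨ solve 5 (λ f v e x p → f :* (v :+ e :* x) :- p := e :* (f :* x) :- (p :- f :* v)) refl
           (ι (c !)) (V (suc j) (suc c) M) (elem (suc j) M) (ρ (suc M) (suc c)) p ⟩
    elem (suc j) M * (ι (c !) * ρ (suc M) (suc c)) - defect (suc j) c M ∎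
    where
    open ≡-Reasoning
    p = inv c ^ℚ (suc (suc j))

  -- Part III: estimates.

  elem-nonNeg : ∀ k n → 0ℚ ≤ elem k n
  elem-nonNeg zero    n       = 0≤1
  elem-nonNeg (suc k) zero    = ≤-refl
  elem-nonNeg (suc k) (suc n) = +-nonNeg (elem-nonNeg (suc k) n) (*-nonNeg (elem-nonNeg k n) (inv-nonNeg (suc n)))

  elem-step : ∀ k n → elem k n ≤ elem k (suc n)
  elem-step zero    n = ≤-refl
  elem-step (suc k) n = ≤-trans (≤-reflexive (sym (+-identityʳ _)))
    (+-monoʳ-≤ (elem (suc k) n) (*-nonNeg (elem-nonNeg k n) (inv-nonNeg (suc n))))

  elem-mono : ∀ k {n n'} → n ℕ.≤ n' → elem k n ≤ elem k n'
  elem-mono k {n} {n'} n≤n' = ≤-trans (grow (n' ℕ.∸ n)) (≤-reflexive (cong (elem k) (ℕP.m+[n∸m]≡n n≤n')))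
    where
    grow : ∀ d → elem k n ≤ elem k (n ℕ.+ d)
    grow zero    = ≤-reflexive (cong (elem k) (sym (ℕP.+-identityʳ n)))
    grow (suc d) = ≤-trans (grow d) (≤-trans (elem-step k (n ℕ.+ d)) (≤-reflexive (cong (elem k) (sym (ℕP.+-suc n d)))))

  elemSum : ℕ → ℕ → ℚ
  elemSum zero    M = 1ℚ
  elemSum (suc j) M = elemSum j M + elem (suc j) M

  elemSum-nonNeg : ∀ j M → 0ℚ ≤ elemSum j M
  elemSum-nonNeg zero    M = 0≤1
  elemSum-nonNeg (suc j) M = +-nonNeg (elemSum-nonNeg j M) (elem-nonNeg (suc j) M)

  elem≤elemSum : ∀ j M → elem j M ≤ elemSum j M
  elem≤elemSum zero    M = ≤-refl
  elem≤elemSum (suc j) M = ≤-trans (≤-reflexive (sym (+-identityˡ _))) (+-monoˡ-≤ (elem (suc j) M) (elemSum-nonNeg j M))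

  ρ-nonNeg : ∀ n p → 0ℚ ≤ ρ n p
  ρ-nonNeg n p = inv-nonNeg (rising n p)

  R-nonNeg : ∀ c M → 0ℚ ≤ R c M
  R-nonNeg c M = *-nonNeg (ι-nonNeg (c !)) (ρ-nonNeg (suc M) c)

  boundary≤R : ∀ c M → ι (c !) * ρ (suc M) (suc c) ≤ R c M
  boundary≤R c M = begin
    ι (c !) * ρ (suc M) (suc c)                  ≡⟨ cong (ι (c !) *_) (ρ-suc-last (suc M) c) ⟩
    ι (c !) * (ρ (suc M) c * inv (suc M ℕ.+ c))  ≡⟨ sym (*-assoc (ι (c !)) _ _) ⟩
    R c M * inv (suc M ℕ.+ c)                    ≤⟨ mulˡ-≤ (R-nonNeg c M) (inv≤1 (suc M ℕ.+ c)) ⟩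
    R c M * 1ℚ                                   ≡⟨ *-identityʳ _ ⟩
    R c M                                        ∎
    where open ≤-Reasoning

  R-step : ∀ c M → R (suc c) M ≤ R c M
  R-step c M = begin
    ι (suc c ℕ.* c !) * ρ (suc M) (suc c)                   ≡⟨ cong₂ _*_ (ι-* (suc c) (c !)) (ρ-suc-last (suc M) c) ⟩
    ι (suc c) * ι (c !) * (ρ (suc M) c * inv (suc M ℕ.+ c))
      ≡⟨ solve 4 (λ i f r v → i :* f :* (r :* v) := f :* r :* (i :* v)) refl (ι (suc c)) (ι (c !)) (ρ (suc M) c) (inv (suc M ℕ.+ c)) ⟩
    R c M * (ι (suc c) * inv (suc M ℕ.+ c))                 ≤⟨ mulˡ-≤ (R-nonNeg c M) (ι*inv≤1 (ℕ.s≤s (ℕP.m≤n+m c M))) ⟩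
    R c M * 1ℚ                                              ≡⟨ *-identityʳ _ ⟩
    R c M                                                   ∎
    where open ≤-Reasoning

  R-anti : ∀ {c c'} M → c ℕ.≤ c' → R c' M ≤ R c M
  R-anti {c} M c≤c' = ≤-trans (≤-reflexive (cong (λ z → R z M) (sym (ℕP.m∸n+n≡m c≤c')))) (go (_ ℕ.∸ c))
    where
    go : ∀ e → R (e ℕ.+ c) M ≤ R c M
    go zero    = ≤-refl
    go (suc e) = ≤-trans (R-step (e ℕ.+ c) M) (go e)

  ρ-1-1 : ∀ M → ρ (suc M) 1 ≡ inv (suc M)
  ρ-1-1 M = cong inv (trans (ℕP.*-identityˡ (suc M ℕ.+ 0)) (ℕP.+-identityʳ (suc M)))

  M*R-2 : ∀ M → ι M * R 2 M ≤ ι 2 * inv (suc M)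
  M*R-2 M = begin
    ι M * (ι 2 * ρ (suc M) 2)                           ≡⟨ cong (λ z → ι M * (ι 2 * z)) (trans (ρ-suc-last (suc M) 1) (cong (_* inv (suc M ℕ.+ 1)) (ρ-1-1 M))) ⟩
    ι M * (ι 2 * (inv (suc M) * inv (suc M ℕ.+ 1)))
      ≡⟨ solve 4 (λ m t a b → m :* (t :* (a :* b)) := t :* a :* (m :* b)) refl (ι M) (ι 2) (inv (suc M)) (inv (suc M ℕ.+ 1)) ⟩
    ι 2 * inv (suc M) * (ι M * inv (suc M ℕ.+ 1))      ≤⟨ mulˡ-≤ (*-nonNeg (ι-nonNeg 2) (inv-nonNeg (suc M))) (ι*inv≤1 (ℕP.≤-trans (ℕP.n≤1+n M) (ℕP.m≤m+n (suc M) 1))) ⟩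
    ι 2 * inv (suc M) * 1ℚ                             ≡⟨ *-identityʳ _ ⟩
    ι 2 * inv (suc M)                                  ∎
    where open ≤-Reasoning

  Σ<-mono : ∀ n {f g : ℕ → ℚ} → (∀ t → f t ≤ g t) → Σ< n f ≤ Σ< n g
  Σ<-mono zero    h = ≤-refl
  Σ<-mono (suc n) h = +-mono-≤ (h 0) (Σ<-mono n (λ t → h (suc t)))

  Σ<-bounded : ∀ n {f : ℕ → ℚ} K → (∀ t → f t ≤ K) → Σ< n f ≤ ι n * K
  Σ<-bounded zero    K h = ≤-reflexive (sym (*-zeroˡ K))
  Σ<-bounded (suc n) K h = ≤-trans (+-mono-≤ (h 0) (Σ<-bounded n K (λ t → h (suc t))))
    (≤-reflexive (solve 2 (λ k i → k :+ i :* k := (i :+ con 1ℚ) :* k) refl K (ι n)))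

  Σ<-abs : ∀ n (f : ℕ → ℚ) → ∣ Σ< n f ∣ ≤ Σ< n (λ t → ∣ f t ∣)
  Σ<-abs zero    f = ≤-refl
  Σ<-abs (suc n) f = ≤-trans (∣p+q∣≤∣p∣+∣q∣ (f 0) _) (+-monoʳ-≤ ∣ f 0 ∣ (Σ<-abs n (λ t → f (suc t))))

  -- All boundary terms together are O(1/M): the first is 1/(M+1) and each of
  -- the at most M others is at most 2/((M+1)(M+2)).
  R-sum : ∀ M d c → 1 ℕ.≤ c → d ℕ.≤ suc M → Σ< d (λ t → R (c ℕ.+ t) M) ≤ ι 3 * inv (suc M)
  R-sum M zero    c _   _ = *-nonNeg (ι-nonNeg 3) (inv-nonNeg (suc M))
  R-sum M (suc d) c 1≤c (ℕ.s≤s d≤M) = ≤-trans (+-mono-≤ first rest)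
    (≤-reflexive (solve 1 (λ a → a :+ con (ι 2) :* a := con (ι 3) :* a) refl (inv (suc M))))
    where
    first : R (c ℕ.+ 0) M ≤ inv (suc M)
    first = ≤-trans (R-anti M (ℕP.≤-trans 1≤c (ℕP.m≤m+n c 0)))
      (≤-reflexive (trans (*-identityˡ (ρ (suc M) 1)) (ρ-1-1 M)))
    rest : Σ< d (λ t → R (c ℕ.+ suc t) M) ≤ ι 2 * inv (suc M)
    rest = ≤-trans (Σ<-bounded d (R 2 M) (λ t → R-anti M (subst (2 ℕ.≤_) (sym (ℕP.+-suc c t)) (ℕ.s≤s (ℕP.≤-trans 1≤c (ℕP.m≤m+n c t))))))
      (≤-trans (mulʳ-≤ (R-nonNeg 2 M) (ι-mono d≤M)) (M*R-2 M))

  defect-bounds : ∀ j c' M → (0ℚ ≤ defect j (suc c') M) × (defect j (suc c') M ≤ R (suc c') M * elemSum j M)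
  defect-bounds zero c' M = lower , upper
    where
    c = suc c'
    lower : 0ℚ ≤ defect 0 c M
    lower = ≤-trans (*-nonNeg (inv-nonNeg c) (R-nonNeg c M)) (≤-reflexive (sym (defect-0 c' M)))
    upper : defect 0 c M ≤ R c M * 1ℚ
    upper = begin
      defect 0 c M  ≡⟨ defect-0 c' M ⟩
      inv c * R c M ≤⟨ mulʳ-≤ (R-nonNeg c M) (inv≤1 c) ⟩
      1ℚ * R c M    ≡⟨ *-comm 1ℚ (R c M) ⟩
      R c M * 1ℚ    ∎
      where open ≤-Reasoning
  defect-bounds (suc j) c' M = lower , upper
    where
    c = suc c'
    e = elem (suc j) M
    X = defect j c M + e * R c M
    ih = defect-bounds j c' M
    X-nonNeg : 0ℚ ≤ X
    X-nonNeg = +-nonNeg (proj₁ ih) (*-nonNeg (elem-nonNeg (suc j) M) (R-nonNeg c M))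
    lower : 0ℚ ≤ defect (suc j) c M
    lower = ≤-trans (*-nonNeg (inv-nonNeg c) X-nonNeg) (≤-reflexive (sym (defect-suc j c' M)))
    upper : defect (suc j) c M ≤ R c M * elemSum (suc j) M
    upper = begin
      defect (suc j) c M                  ≡⟨ defect-suc j c' M ⟩
      inv c * X                           ≤⟨ mulʳ-≤ X-nonNeg (inv≤1 c) ⟩
      1ℚ * X                              ≡⟨ *-identityˡ X ⟩
      defect j c M + e * R c M            ≤⟨ +-monoˡ-≤ (e * R c M) (proj₂ ih) ⟩
      R c M * elemSum j M + e * R c M     ≡⟨ solve 3 (λ r g e → r :* g :+ e :* r := r :* (g :+ e)) refl (R c M) (elemSum j M) e ⟩
      R c M * elemSum (suc j) M           ∎
      where open ≤-Reasoning

  ∣a-b∣≤a+b : ∀ {a b} → 0ℚ ≤ a → 0ℚ ≤ b → ∣ a - b ∣ ≤ a + b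
  ∣a-b∣≤a+b {a} {b} ha hb = ≤-trans (∣p-q∣≤∣p∣+∣q∣ a b) (≤-reflexive (cong₂ _+_ (0≤p⇒∣p∣≡p ha) (0≤p⇒∣p∣≡p hb)))

  Tₙ-error-bound : ∀ j c' M →
    ∣ Tₙ (suc j) M (suc c') - inv (suc c') ^ℚ (suc (suc j)) ∣ ≤ ι 2 * elemSum (suc j) M * R (suc c') M
  Tₙ-error-bound j c' M = begin
    ∣ Tₙ (suc j) M c - inv c ^ℚ (suc (suc j)) ∣   ≡⟨ cong ∣_∣ (Tₙ-error j c M) ⟩
    ∣ e * Z - defect (suc j) c M ∣                ≤⟨ ∣a-b∣≤a+b (*-nonNeg (elem-nonNeg (suc j) M) Z-nonNeg) (proj₁ bounds) ⟩
    e * Z + defect (suc j) c M                    ≤⟨ +-mono-≤ (mul-≤ (elemSum-nonNeg (suc j) M) Z-nonNeg (elem≤elemSum (suc j) M) (boundary≤R c M)) (proj₂ bounds) ⟩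
    G * R c M + R c M * G                         ≡⟨ solve 2 (λ g r → g :* r :+ r :* g := con (ι 2) :* g :* r) refl G (R c M) ⟩
    ι 2 * G * R c M                               ∎
    where
    open ≤-Reasoning
    c = suc c'
    e = elem (suc j) M
    G = elemSum (suc j) M
    Z = ι (c !) * ρ (suc M) (suc c)
    Z-nonNeg = *-nonNeg (ι-nonNeg (c !)) (ρ-nonNeg (suc M) (suc c))
    bounds = defect-bounds (suc j) c' M

  S-nonNeg : ∀ k M p → 0ℚ ≤ S k M p
  S-nonNeg k zero    p = ≤-refl
  S-nonNeg k (suc M) p = +-nonNeg (S-nonNeg k M p) (*-nonNeg (elem-nonNeg k (suc M)) (ρ-nonNeg (suc M) p))

  Sₙ-remainder-bound : ∀ k M → Sₙ k M (suc M) ≤ elem k M * inv (suc M)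
  Sₙ-remainder-bound k M = begin
    ι F * S k M (suc (suc M))                          ≤⟨ mulˡ-≤ (ι-nonNeg F) (S≤elem*V M ℕP.≤-refl) ⟩
    ι F * (e * V 0 (suc (suc M)) M)                    ≡⟨ cong (λ z → ι F * (e * z)) (ι-solve M (V-0 (suc M) M)) ⟩
    ι F * (e * (inv (suc M) * (ρ 1 (suc M) - r)))
      ≡⟨ solve 5 (λ f e a x y → f :* (e :* (a :* (x :- y))) := e :* (a :* (f :* x :- f :* y))) refl (ι F) e (inv (suc M)) (ρ 1 (suc M)) r ⟩
    e * (inv (suc M) * (ι F * ρ 1 (suc M) - ι F * r)) ≡⟨ cong (λ z → e * (inv (suc M) * (z - ι F * r))) (ρ-1 (suc M)) ⟩
    e * (inv (suc M) * (1ℚ - ι F * r))                 ≤⟨ mulˡ-≤ (elem-nonNeg k M) (mulˡ-≤ (inv-nonNeg (suc M)) 1-Fr≤1) ⟩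
    e * (inv (suc M) * 1ℚ)                             ≡⟨ cong (e *_) (*-identityʳ _) ⟩
    e * inv (suc M)                                    ∎
    where
    open ≤-Reasoning
    F = suc M !
    e = elem k M
    r = ρ (suc M) (suc M)
    1-Fr≤1 : 1ℚ - ι F * r ≤ 1ℚ
    1-Fr≤1 = ≤-of-0≤- (≤-trans (*-nonNeg (ι-nonNeg F) (ρ-nonNeg (suc M) (suc M)))
      (≤-reflexive (sym (solve 1 (λ y → con 1ℚ :- (con 1ℚ :- y) := y) refl (ι F * r)))))
    -- e_k is increasing in n, so e_k(n) ≤ e_k(M) throughout the sum
    S≤elem*V : ∀ N → N ℕ.≤ M → S k N (suc (suc M)) ≤ e * V 0 (suc (suc M)) N
    S≤elem*V zero    _   = ≤-reflexive (sym (*-zeroʳ e))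
    S≤elem*V (suc N) N<M = ≤-trans
      (+-mono-≤ (S≤elem*V N (ℕP.≤-trans (ℕP.n≤1+n N) N<M)) (mulʳ-≤ (ρ-nonNeg (suc N) (suc (suc M))) (elem-mono k N<M)))
      (≤-reflexive (solve 3 (λ e v r → e :* v :+ e :* r := e :* (v :+ con 1ℚ :* r)) refl e (V 0 (suc (suc M)) N) (ρ (suc N) (suc (suc M)))))

  -- e_i(n)² ≤ 9^i (n+1): a crude growth bound, proved by induction on n from
  -- e_{i+1}(n+1) = e_{i+1}(n) + e_i(n)/(n+1) and an explicit sum-of-nonnegative-terms identity.
  elem-square-bound : ∀ i n → elem i n * elem i n ≤ ι (9 ℕ.^ i) * ι (suc n)
  elem-square-bound zero    n = ≤-trans (ι-mono {1} {suc n} (ℕ.s≤s ℕ.z≤n)) (≤-reflexive (sym (*-identityˡ (ι (suc n)))))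
  elem-square-bound (suc i) zero = *-nonNeg (ι-nonNeg (9 ℕ.^ suc i)) (ι-nonNeg 1)
  elem-square-bound (suc i) (suc n) = ≤-of-0≤- (nonNeg-of-3× (≤-trans
    (+-nonNeg (+-nonNeg (+-nonNeg (+-nonNeg term₁ term₂) term₃) term₄) term₅) (≤-reflexive (sym identity))))
    where
    a = elem (suc i) n
    b = elem i n
    t = inv (suc n)
    Z = ι (9 ℕ.^ i)
    N = ι (suc n)
    three = ι 3
    nonNeg-of-3× : ∀ {x} → 0ℚ ≤ three * x → 0ℚ ≤ x
    nonNeg-of-3× h = ≤-trans (*-nonNeg (inv-nonNeg 3) h) (≤-reflexive (sym (ι-solve 2 refl)))
    ih-a : 0ℚ ≤ ι 9 * Z * N - a * a
    ih-a = 0≤-of-≤ (≤-trans (elem-square-bound (suc i) n) (≤-reflexive (cong (_* N) (ι-* 9 (9 ℕ.^ i)))))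
    ih-b : 0ℚ ≤ Z * N - b * b
    ih-b = 0≤-of-≤ (elem-square-bound i n)
    term₁ : 0ℚ ≤ (ι 9 * Z * N - a * a) * (three + t)
    term₁ = *-nonNeg ih-a (+-nonNeg (ι-nonNeg 3) (inv-nonNeg (suc n)))
    term₂ : 0ℚ ≤ t * ((a - three * b) * (a - three * b))
    term₂ = *-nonNeg (inv-nonNeg (suc n)) (square-nonNeg (a - three * b))
    term₃ : 0ℚ ≤ (ι 9 * t + three * (t * t)) * (Z * N - b * b)
    term₃ = *-nonNeg (+-nonNeg (*-nonNeg (ι-nonNeg 9) (inv-nonNeg (suc n)))
      (*-nonNeg (ι-nonNeg 3) (*-nonNeg (inv-nonNeg (suc n)) (inv-nonNeg (suc n))))) ih-b
    term₄ : 0ℚ ≤ three * Z * (three - t)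
    term₄ = *-nonNeg (*-nonNeg (ι-nonNeg 3) (ι-nonNeg (9 ℕ.^ i))) (0≤-of-≤ (≤-trans (inv≤1 (suc n)) (ι-mono {1} {3} (ℕ.s≤s ℕ.z≤n))))
    term₅ : 0ℚ ≤ three * Z * (ι 6 + t) * (1ℚ - t * N)
    term₅ = ≤-reflexive (sym (trans (cong (λ z → three * Z * (ι 6 + t) * (1ℚ - z)) (inv-cancelˡ n)) (*-zeroʳ (three * Z * (ι 6 + t)))))
    identity : three * (ι (9 ℕ.^ suc i) * ι (suc (suc n)) - elem (suc i) (suc n) * elem (suc i) (suc n))
      ≡ (ι 9 * Z * N - a * a) * (three + t) + t * ((a - three * b) * (a - three * b))
        + (ι 9 * t + three * (t * t)) * (Z * N - b * b) + three * Z * (three - t) + three * Z * (ι 6 + t) * (1ℚ - t * N)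
    identity = trans (cong (λ z → three * (z * (N + 1ℚ) - (a + b * t) * (a + b * t))) (ι-* 9 (9 ℕ.^ i)))
      (solve 5 (λ a b t Z N →
        con three :* (con (ι 9) :* Z :* (N :+ con 1ℚ) :- (a :+ b :* t) :* (a :+ b :* t))
        := (con (ι 9) :* Z :* N :- a :* a) :* (con three :+ t) :+ t :* ((a :- con three :* b) :* (a :- con three :* b))
          :+ (con (ι 9) :* t :+ con three :* (t :* t)) :* (Z :* N :- b :* b) :+ con three :* Z :* (con three :- t)
          :+ con three :* Z :* (con (ι 6) :+ t) :* (con 1ℚ :- t :* N)) refl a b t Z N)

  elem-sublinear : ∀ i M L → 9 ℕ.^ i ℕ.* L ℕ.* L ℕ.≤ suc M → elem i M * ι L ≤ ι (suc M)
  elem-sublinear i M L small = square-mono⁻¹ (ι-nonNeg (suc M)) (begin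
    (e * ι L) * (e * ι L)            ≡⟨ solve 2 (λ e l → (e :* l) :* (e :* l) := e :* e :* (l :* l)) refl e (ι L) ⟩
    e * e * (ι L * ι L)              ≤⟨ mulʳ-≤ (square-nonNeg (ι L)) (elem-square-bound i M) ⟩
    ι (9 ℕ.^ i) * m * (ι L * ι L)    ≡⟨ solve 3 (λ z m l → z :* m :* (l :* l) := z :* l :* l :* m) refl (ι (9 ℕ.^ i)) m (ι L) ⟩
    ι (9 ℕ.^ i) * ι L * ι L * m      ≡⟨ cong (_* m) (sym (trans (ι-* (9 ℕ.^ i ℕ.* L) L) (cong (_* ι L) (ι-* (9 ℕ.^ i) L)))) ⟩
    ι (9 ℕ.^ i ℕ.* L ℕ.* L) * m      ≤⟨ mulʳ-≤ (ι-nonNeg (suc M)) (ι-mono small) ⟩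
    m * m                            ∎)
    where
    open ≤-Reasoning
    e = elem i M
    m = ι (suc M)

  elemSum-sublinear : ∀ k M L → 9 ℕ.^ k ℕ.* L ℕ.* L ℕ.≤ suc M → elemSum k M * ι L ≤ ι (suc k) * ι (suc M)
  elemSum-sublinear k M L small = go k ℕP.≤-refl
    where
    each : ∀ i → i ℕ.≤ k → elem i M * ι L ≤ ι (suc M)
    each i i≤k = elem-sublinear i M L (ℕP.≤-trans (ℕP.*-monoˡ-≤ L (ℕP.*-monoˡ-≤ L (ℕP.^-monoʳ-≤ 9 i≤k))) small)
    go : ∀ j → j ℕ.≤ k → elemSum j M * ι L ≤ ι (suc j) * ι (suc M)
    go zero    _    = ≤-trans (each 0 ℕ.z≤n) (≤-reflexive (sym (*-identityˡ (ι (suc M)))))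
    go (suc j) j<k  = ≤-trans
      (≤-trans (≤-reflexive (*-distribʳ-+ (ι L) (elemSum j M) (elem (suc j) M)))
        (+-mono-≤ (go j (ℕP.≤-trans (ℕP.n≤1+n j) j<k)) (each (suc j) j<k)))
      (≤-reflexive (solve 2 (λ i m → i :* m :+ m := (i :+ con 1ℚ) :* m) refl (ι (suc j)) (ι (suc M))))

  archimedean : ∀ ε → 0ℚ < ε → ∃ λ K → inv (suc K) ≤ ε
  archimedean (mkℚ (ℤ.+ zero)    _ _) 0<ε = ⊥-elim (ℤ.Positive.pos (positive 0<ε))
  archimedean (mkℚ ℤ.-[1+ _ ]    _ _) 0<ε = ⊥-elim (ℤ.Positive.pos (positive 0<ε))
  archimedean (mkℚ (ℤ.+ (suc a)) b _) 0<ε = b , toℚᵘ-cancel-≤ (UP.≤-respˡ-≃ (UP.≃-sym (toℚᵘ-fromℚᵘ (U.mkℚᵘ (ℤ.+ 1) b)))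
    (U.*≤* (ℤ.+≤+ (ℕP.*-monoˡ-≤ (suc b) {1} {suc a} (ℕ.s≤s ℕ.z≤n)))))

  -- For q = c + 1, c = c' + 1 and M = c' + d, the difference of the partial sums is
  -- (1/c!)·[Sₙ k M (M+1) + Σ_{t<d} (Tₙ k M (c+t) − (c+t)^{-(k+1)})]: telescope the
  -- left side from c up to M + 1 = c + d and split off H_{c'}^{(k+1)} on the right.
  difference-identity : ∀ k c' d →
    lhsPartial k (suc (suc c')) (c' ℕ.+ d) - rhsPartial k (suc (suc c')) (c' ℕ.+ d)
      ≡ inv (suc c' !) * (Sₙ k (c' ℕ.+ d) (suc (c' ℕ.+ d))
                          + Σ< d (λ t → Tₙ k (c' ℕ.+ d) (suc c' ℕ.+ t) - inv (suc c' ℕ.+ t) ^ℚ suc k))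
  difference-identity k c' d = begin
    lhsPartial k (suc c) M - rhsPartial k (suc c) M
      ≡⟨ cong₂ _-_ lhs≡ (cong (inv (c !) *_) (cong (_- H (suc k) c') (H-split (suc k) c' d))) ⟩
    inv (c !) * (A + Σ< d f) - inv (c !) * ((H (suc k) c' + Σ< d g) - H (suc k) c')
      ≡⟨ solve 5 (λ i a f h g → i :* (a :+ f) :- i :* ((h :+ g) :- h) := i :* (a :+ (f :- g))) refl
           (inv (c !)) A (Σ< d f) (H (suc k) c') (Σ< d g) ⟩
    inv (c !) * (A + (Σ< d f - Σ< d g))           ≡⟨ cong (λ z → inv (c !) * (A + z)) (sym (Σ<-sub d f g)) ⟩
    inv (c !) * (A + Σ< d (λ t → f t - g t))      ∎
    where
    open ≡-Reasoning
    c = suc c'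
    M = c' ℕ.+ d
    A = Sₙ k M (suc M)
    f g : ℕ → ℚ
    f t = Tₙ k M (c ℕ.+ t)
    g t = inv (c ℕ.+ t) ^ℚ suc k
    lhs≡ : lhsPartial k (suc c) M ≡ inv (c !) * (A + Σ< d f)
    lhs≡ = begin
      lhsPartial k (suc c) M               ≡⟨ Σ1-cong M (λ n → cong (_* ρ n (suc c)) (P-harmonic k n)) ⟩
      S k M (suc c)                        ≡⟨ ι-solve′ ⟩
      inv (c !) * Sₙ k M c                 ≡⟨ cong (inv (c !) *_) (Sₙ-telescope k M d c) ⟩
      inv (c !) * (A + Σ< d f)             ∎
      where
      ι-solve′ : S k M (suc c) ≡ inv (c !) * (ι (c !) * S k M (suc c))
      ι-solve′ = trans (sym (*-identityˡ _))
        (trans (cong (_* S k M (suc c)) (sym (trans (*-comm (inv (c !)) (ι (c !))) (inv-! c)))) (*-assoc (inv (c !)) (ι (c !)) (S k M (suc c))))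

  -- |difference| ≤ 7·(e_0(M) + ⋯ + e_k(M))/(M+1): the remainder contributes at most one
  -- such term and the d errors of the Tₙ, by Tₙ-error-bound and R-sum, at most six.
  difference-bound : ∀ j c' M → c' ℕ.≤ M →
    ∣ lhsPartial (suc j) (suc (suc c')) M - rhsPartial (suc j) (suc (suc c')) M ∣ ≤ ι 7 * elemSum (suc j) M * inv (suc M)
  difference-bound j c' M c'≤M with M ℕ.∸ c' | ℕP.m+[n∸m]≡n c'≤M
  ... | d | refl = begin
    ∣ lhsPartial k q M - rhsPartial k q M ∣   ≡⟨ cong ∣_∣ (difference-identity k c' d) ⟩
    ∣ inv (c !) * (A + Σ< d err) ∣            ≡⟨ ∣p*q∣≡∣p∣*∣q∣ (inv (c !)) (A + Σ< d err) ⟩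
    ∣ inv (c !) ∣ * ∣ A + Σ< d err ∣          ≤⟨ mulʳ-≤ (0≤∣p∣ (A + Σ< d err)) (≤-trans (≤-reflexive (0≤p⇒∣p∣≡p (inv-nonNeg (c !)))) (inv≤1 (c !))) ⟩
    1ℚ * ∣ A + Σ< d err ∣                     ≡⟨ *-identityˡ _ ⟩
    ∣ A + Σ< d err ∣                          ≤⟨ ∣p+q∣≤∣p∣+∣q∣ A (Σ< d err) ⟩
    ∣ A ∣ + ∣ Σ< d err ∣                      ≤⟨ +-mono-≤ (≤-reflexive (0≤p⇒∣p∣≡p A-nonNeg)) (Σ<-abs d err) ⟩
    A + Σ< d (λ t → ∣ err t ∣)
      ≤⟨ +-mono-≤ (≤-trans (Sₙ-remainder-bound k M) (mulʳ-≤ (inv-nonNeg (suc M)) (elem≤elemSum k M)))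
                  (Σ<-mono d (λ t → Tₙ-error-bound j (c' ℕ.+ t) M)) ⟩
    G * a + Σ< d (λ t → ι 2 * G * R (c ℕ.+ t) M) ≡⟨ cong (G * a +_) (Σ<-*ˡ d (ι 2 * G) (λ t → R (c ℕ.+ t) M)) ⟩
    G * a + ι 2 * G * Σ< d (λ t → R (c ℕ.+ t) M)
      ≤⟨ +-monoʳ-≤ (G * a) (mulˡ-≤ (*-nonNeg (ι-nonNeg 2) (elemSum-nonNeg k M)) (R-sum M d c (ℕ.s≤s ℕ.z≤n) (ℕP.≤-trans (ℕP.m≤n+m d c') (ℕP.n≤1+n M)))) ⟩
    G * a + ι 2 * G * (ι 3 * a)               ≡⟨ solve 2 (λ g a → g :* a :+ con (ι 2) :* g :* (con (ι 3) :* a) := con (ι 7) :* g :* a) refl G a ⟩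
    ι 7 * G * a                               ∎
    where
    open ≤-Reasoning
    k = suc j
    c = suc c'
    q = suc c
    a = inv (suc M)
    G = elemSum k M
    A = Sₙ k M (suc M)
    err : ℕ → ℚ
    err t = Tₙ k M (c ℕ.+ t) - inv (c ℕ.+ t) ^ℚ suc k
    A-nonNeg : 0ℚ ≤ A
    A-nonNeg = *-nonNeg (ι-nonNeg (suc M !)) (S-nonNeg k M (suc (suc M)))

  elemSum/M≤ : ∀ k M L → 9 ℕ.^ k ℕ.* suc L ℕ.* suc L ℕ.≤ suc M →
    elemSum k M * inv (suc M) ≤ ι (suc k) * inv (suc L)
  elemSum/M≤ k M L small = begin
    G * inv (suc M)                                      ≡⟨ sym (*-identityʳ _) ⟩
    G * inv (suc M) * 1ℚ                                 ≡⟨ cong (G * inv (suc M) *_) (sym (inv-cancelʳ L)) ⟩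
    G * inv (suc M) * (ι (suc L) * inv (suc L))          ≡⟨ solve 4 (λ g m l il → g :* m :* (l :* il) := g :* l :* (il :* m)) refl G (inv (suc M)) (ι (suc L)) (inv (suc L)) ⟩
    G * ι (suc L) * (inv (suc L) * inv (suc M))          ≤⟨ mulʳ-≤ (*-nonNeg (inv-nonNeg (suc L)) (inv-nonNeg (suc M))) (elemSum-sublinear k M (suc L) small) ⟩
    ι (suc k) * ι (suc M) * (inv (suc L) * inv (suc M))  ≡⟨ solve 4 (λ k m l im → k :* m :* (l :* im) := k :* l :* (m :* im)) refl (ι (suc k)) (ι (suc M)) (inv (suc L)) (inv (suc M)) ⟩
    ι (suc k) * inv (suc L) * (ι (suc M) * inv (suc M))  ≡⟨ trans (cong (ι (suc k) * inv (suc L) *_) (inv-cancelʳ M)) (*-identityʳ _) ⟩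
    ι (suc k) * inv (suc L)                              ∎
    where
    open ≤-Reasoning
    G = elemSum k M

  inv-scale : ∀ k K → ι (suc k) * inv (suc K ℕ.* (8 ℕ.* suc k)) ≡ inv 8 * inv (suc K)
  inv-scale k K = begin
    ι (suc k) * inv (suc K ℕ.* (8 ℕ.* suc k))
      ≡⟨ cong (ι (suc k) *_) (trans (inv-* (suc K) (8 ℕ.* suc k)) (cong (inv (suc K) *_) (inv-* 8 (suc k)))) ⟩
    ι (suc k) * (inv (suc K) * (inv 8 * inv (suc k)))
      ≡⟨ solve 4 (λ a b c d → a :* (b :* (c :* d)) := c :* b :* (a :* d)) refl (ι (suc k)) (inv (suc K)) (inv 8) (inv (suc k)) ⟩
    inv 8 * inv (suc K) * (ι (suc k) * inv (suc k))
      ≡⟨ trans (cong (inv 8 * inv (suc K) *_) (inv-cancelʳ k)) (*-identityʳ _) ⟩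
    inv 8 * inv (suc K) ∎
    where open ≡-Reasoning

  difference-small : ∀ j c' K M → let k = suc j ; L = suc K ℕ.* (8 ℕ.* suc k) in
    c' ℕ.+ 9 ℕ.^ k ℕ.* L ℕ.* L ℕ.≤ M →
    ∣ lhsPartial k (suc (suc c')) M - rhsPartial k (suc (suc c')) M ∣ ≤ ι 7 * inv 8 * inv (suc K)
  difference-small j c' K M N≤M = begin
    ∣ lhsPartial k (suc (suc c')) M - rhsPartial k (suc (suc c')) M ∣
                                       ≤⟨ difference-bound j c' M (ℕP.≤-trans (ℕP.m≤m+n c' _) N≤M) ⟩
    ι 7 * elemSum k M * inv (suc M)    ≡⟨ *-assoc (ι 7) (elemSum k M) (inv (suc M)) ⟩
    ι 7 * (elemSum k M * inv (suc M))  ≤⟨ mulˡ-≤ (ι-nonNeg 7) (elemSum/M≤ k M _ (ℕP.≤-trans (ℕP.m≤n+m _ c') (ℕP.≤-trans N≤M (ℕP.n≤1+n M)))) ⟩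
    ι 7 * (ι (suc k) * inv L)          ≡⟨ trans (cong (ι 7 *_) (inv-scale k K)) (sym (*-assoc (ι 7) (inv 8) (inv (suc K)))) ⟩
    ι 7 * inv 8 * inv (suc K)          ∎
    where
    open ≤-Reasoning
    k = suc j
    L = suc K ℕ.* (8 ℕ.* suc k)

  seven-eighths<1 : ι 7 * inv 8 < 1ℚ
  seven-eighths<1 = toWitness {a? = ι 7 * inv 8 <? 1ℚ} _

open import Data.Nat using (ℕ; _≤_)
open import Data.Product using (∃)
open import Data.Rational using (ℚ; 0ℚ; _<_; _-_; ∣_∣)
import Data.Nat as ℕ
open import Data.Nat using (zero; suc; s≤s)
open import Data.Product using (_,_; proj₁; proj₂)
open import Data.Rational using (1ℚ; _*_; positive)
open import Data.Rational.Properties using (*-identityˡ; *-monoˡ-<-pos; module ≤-Reasoning)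
open Proof using (ι; mulˡ-≤; *-nonNeg; ι-nonNeg; inv-nonNeg; archimedean; difference-small; seven-eighths<1)

-- Choose K with 1/(K+1) ≤ ε; by difference-small the difference is eventually
-- at most (7/8)/(K+1) < ε.
corollary5p12 : (k q : ℕ) → 1 ≤ k → 2 ≤ q →
    (ε : ℚ) → 0ℚ < ε →
    ∃ λ N → (M : ℕ) → N ≤ M → ∣ lhsPartial k q M - rhsPartial k q M ∣ < ε
corollary5p12 zero    _              ()  _        _ _
corollary5p12 (suc j) zero           _   ()       _ _
corollary5p12 (suc j) (suc zero)     _   (s≤s ()) _ _
corollary5p12 (suc j) (suc (suc c')) _   _        ε 0<ε = c' ℕ.+ 9 ℕ.^ suc j ℕ.* L ℕ.* L , close
  where
  K = proj₁ (archimedean ε 0<ε)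
  L = suc K ℕ.* (8 ℕ.* suc (suc j))
  close : ∀ M → c' ℕ.+ 9 ℕ.^ suc j ℕ.* L ℕ.* L ≤ M →
    ∣ lhsPartial (suc j) (suc (suc c')) M - rhsPartial (suc j) (suc (suc c')) M ∣ < ε
  close M N≤M = begin-strict
    ∣ lhsPartial (suc j) (suc (suc c')) M - rhsPartial (suc j) (suc (suc c')) M ∣
                               ≤⟨ difference-small j c' K M N≤M ⟩
    ι 7 * inv 8 * inv (suc K)  ≤⟨ mulˡ-≤ (*-nonNeg (ι-nonNeg 7) (inv-nonNeg 8)) (proj₂ (archimedean ε 0<ε)) ⟩
    ι 7 * inv 8 * ε            <⟨ *-monoˡ-<-pos ε {{positive 0<ε}} seven-eighths<1 ⟩
    1ℚ * ε                     ≡⟨ *-identityˡ ε ⟩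
    ε                          ∎
    where open ≤-Reasoning
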